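{- Let $X(\le d)$ be a pure simplicial complex with probability measures $\Pi_1,\dots,\Pi_d$ as in the context, and let $0\le j\le l\le k$ be integers. Let $u$ be an integer with $j\le u\le d-k$. For any $\mathfrak s\in X(k)$ with $\Pi_k(\mathfrak s)>0$, any $\mathfrak s'\subseteq\mathfrak s$ with $|\mathfrak s'|=l-j$, and any $\mathfrak t'\in X(j)$ disjoint from $\mathfrak s$ with $\mathfrak s'\sqcup\mathfrak t'\in X(l)$, \[ \mathbf S^{u}_{k,l,j}(\mathfrak s,\mathfrak s'\sqcup\mathfrak t')=\frac{1}{\binom{k}{l-j}\binom{k+j}{j}}\cdot\frac{\Pi_{k+j}(\mathfrak s\sqcup\mathfrak t')}{\Pi_k(\mathfrak s)}, \] where $\Pi_{k+j}(\mathfrak s\sqcup\mathfrak t'):=0$ if $\mathfrak s\sqcup\mathfrak t'\notin X$. In particular, $\mathbf S^{u}_{k,l,j}$ does not depend on the choice of $u\in[j,d-k]$.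
   Context: A simplicial complex $X$ is a downward-closed family of subsets of $[n]$; $X(i)$ = faces of size $i$; pure $X(\le d)$ means every face lies in a face of size $d$. Given a probability measure $\Pi_d$ on $X(d)$, $\Pi_i$ ($i<d$) is the law of a uniformly random $i$-subset of a $\Pi_d$-random top face (obtained by deleting uniformly random elements one at a time). The up-walk moves from $\mathfrak b\in X(i)$ to $\mathfrak b\sqcup\{x\}$ with probability $\Pi_{i+1}(\mathfrak b\sqcup\{x\})/((i+1)\Pi_i(\mathfrak b))$; $p^{(u)}_{\mathfrak s}$ denotes the law of the face reached after $u$ up-steps from $\mathfrak s$. The $j$-swapping $u$-walk $\mathbf S^{u}_{k,l,j}$ from $X(k)$ to $X(l)$ (defined for $j\le u$, $j\le l\le k$, $k+u\le d$) is the Markov kernel: from $\mathfrak s\in X(k)$, pick $\mathfrak s''\in X(k+u)$ according to $p^{(u)}_{\mathfrak s}$, then move to $\mathfrak s'$ chosen uniformly among the $l$-element subsets of $\mathfrak s''$ with $|\mathfrak s'\cap(\mathfrak s''\setminus\mathfrak s)|=j$. $\mathbf S^u_{k,l,j}(\mathfrak s,\mathfrak t)$ denotes the transition probability from $\mathfrak s$ to $\mathfrak t$.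
   Formalization: The probability measure $\Pi_d$ on $X(d)$ takes rational values. -}

module Defs where

open import Data.Nat as ℕ using (ℕ; zero; suc)
open import Data.Nat.Combinatorics using (_C_)
import Data.Integer
open import Data.Bool using (Bool; true; false; if_then_else_; _∧_)
open import Data.Fin.Subset using (Subset; _⊆_; _∩_; _∪_; _─_; ∣_∣; inside; outside)
open import Data.Fin.Subset.Properties using (_⊆?_)
open import Data.Vec using ([]; _∷_)
open import Data.List using (List; []; _∷_; _++_; map; filter; length; sum)
open import Data.Rational as ℚ using (ℚ; 0ℚ; 1ℚ; _≤_; _+_; _*_; 1/_; ≢-nonZero)
open import Data.Rational.Properties using (_≟_)
open import Data.Product using (_×_; Σ)
open import Relation.Nullary using (Dec; yes; no; ¬_; does)
open import Relation.Binary.PropositionalEquality using (_≡_)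

allSubsets : (n : ℕ) → List (Subset n)
allSubsets zero = [] ∷ []
allSubsets (suc n) = map (outside ∷_) (allSubsets n) ++ map (inside ∷_) (allSubsets n)

Σsub : {n : ℕ} → (Subset n → ℚ) → ℚ
Σsub {n} f = Data.List.foldr (λ s acc → f s + acc) 0ℚ (allSubsets n)

ℕ→ℚ : ℕ → ℚ
ℕ→ℚ m = Data.Integer.+_ m ℚ./ 1

[_] : Bool → ℚ
[ true ] = 1ℚ
[ false ] = 0ℚ

-- division with the convention  p / 0 := 0  (only used where the
-- denominator is nonzero on the relevant support)
_/'_ : ℚ → ℚ → ℚ
p /' q with q ≟ 0ℚ
... | yes _ = 0ℚ
... | no q≢0 = p * (1/_ q {{≢-nonZero q≢0}})

⊆ᵇ : {n : ℕ} → Subset n → Subset n → Bool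
⊆ᵇ a b = does (a ⊆? b)

record IsSimplicialComplex {n : ℕ} (X : Subset n → Bool) : Set where
  field
    downClosed : ∀ a b → a ⊆ b → X b ≡ true → X a ≡ true

record IsPure {n : ℕ} (X : Subset n → Bool) (d : ℕ) : Set where
  field
    sizeBound : ∀ a → X a ≡ true → ∣ a ∣ ℕ.≤ d
    extends   : ∀ a → X a ≡ true → Σ (Subset n) λ f → (a ⊆ f) × (X f ≡ true) × (∣ f ∣ ≡ d)

record IsTopMeasure {n : ℕ} (X : Subset n → Bool) (d : ℕ) (Πd : Subset n → ℚ) : Set where
  field
    nonneg  : ∀ f → 0ℚ ≤ Πd f
    support : ∀ f → ¬ (Πd f ≡ 0ℚ) → (X f ≡ true) × (∣ f ∣ ≡ d)
    total   : Σsub Πd ≡ 1ℚ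

-- Π_i(b): probability that a uniformly random i-subset of a Π_d-random top
-- face equals b (0 if |b| ≠ i, and 0 if b ∉ X since no top face contains b).
Π : {n : ℕ} → (d : ℕ) → (Subset n → ℚ) → ℕ → Subset n → ℚ
Π d Πd i b with ∣ b ∣ ℕ.≟ i
... | no _  = 0ℚ
... | yes _ = Σsub (λ f → [ ⊆ᵇ b f ] * Πd f) /' ℕ→ℚ (d C i)

up : {n : ℕ} → ℕ → (Subset n → ℚ) → Subset n → Subset n → ℚ
up d Πd r t with ∣ t ∣ ℕ.≟ suc ∣ r ∣
... | no _ = 0ℚ
... | yes _ = [ ⊆ᵇ r t ] * (Π d Πd (suc ∣ r ∣) t /' (ℕ→ℚ (suc ∣ r ∣) * Π d Πd ∣ r ∣ r))

pUp : {n : ℕ} → ℕ → (Subset n → ℚ) → ℕ → Subset n → Subset n → ℚ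
pUp d Πd zero s t = [ ⊆ᵇ s t ∧ ⊆ᵇ t s ]
pUp d Πd (suc u) s t = Σsub (λ r → pUp d Πd u s r * up d Πd r t)

admissible : {n : ℕ} → ℕ → ℕ → Subset n → Subset n → Subset n → Bool
admissible l j s s'' t =
  ⊆ᵇ t s'' ∧ does (∣ t ∣ ℕ.≟ l) ∧ does (∣ t ∩ (s'' ─ s) ∣ ℕ.≟ j)

Swalk : {n : ℕ} → (d : ℕ) → (Subset n → ℚ) → (u k l j : ℕ) → Subset n → Subset n → ℚ
Swalk {n} d Πd u k l j s t =
  Σsub (λ s'' → pUp d Πd u s s'' *
    ([ admissible l j s s'' t ] /'
       ℕ→ℚ (length (filter (λ t₀ → admissible l j s s'' t₀ Data.Bool.≟ true) (allSubsets n)))))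

-- By induction on u, the up-walk from s ∈ X(k) has the closed form
--   p^{(u)}_s(t) = [s ⊆ t] Π_{k+u}(t) / (C(k+u, u) Π_k(s)):
-- in one step the factors Π_{k+u}(r) cancel, and the C(|t ─ s|, u) = u + 1 intermediate
-- faces r turn C(k+u, u) (k+u+1) into (u+1) C(k+u+1, u+1).
-- For c ⊇ s, the set s′ ⊔ t′ is admissible in c exactly when t′ ⊆ c, and if |c| = k + u
-- there are C(k, l − j) C(u, j) admissible subsets. Writing Π_m(c) = mass(c) / C(d, m)
-- with mass(c) the Π_d-weight of the top faces containing c, the sum over c counts each top
-- face f ⊇ s ⊔ t′ with multiplicity C(d − k − j, u − j), and a multinomial identity turns the
-- remaining binomials into 1 / (C(k, l − j) C(k + j, j) C(d, k + j)).
module Submission where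

open import Defs
open import Data.Nat as ℕ using (ℕ; zero; suc; _∸_; _!; NonZero)
import Data.Nat.Properties as ℕₚ
open import Data.Nat.Combinatorics
  using (_C_; nCk≡n!/k![n-k]!; k![n∸k]!∣n!; k>n⇒nCk≡0; nCk+nC[k+1]≡[n+1]C[k+1]; nCk≡nC[n∸k]; nC1≡n)
open import Data.Nat.DivMod using (m/n*n≡m)
open import Data.Nat.Tactic.RingSolver using (solve-∀)
import Data.Nat.Coprimality as Coprime
import Data.Integer as ℤ
import Data.Integer.Properties as ℤₚ
open import Data.Rational as ℚ using (ℚ; 0ℚ; 1ℚ; mkℚ; ≢-nonZero)
open import Data.Rational.Properties as ℚₚ using (_≟_)
open import Data.Bool as Bool using (Bool; true; false; _∧_; T)
import Data.Bool.Properties as Boolₚ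
open import Data.List using (List; []; _∷_; _++_; map; filter; foldr; length)
open import Data.Vec using ([]; _∷_; here)
open import Data.Fin.Subset using (Subset; inside; outside; _⊆_; _∩_; _∪_; _─_; ∣_∣; Empty)
import Data.Fin as Fin
import Data.Sum as Sum
open import Data.Fin.Subset.Properties
  using (_⊆?_; ⊆-trans; ⊆-antisym; drop-∷-⊆; drop-∷-Empty; out⊆; in⊆in; p⊆p∪q; q⊆p∪q; x∈p∪q⁻)
open import Function.Bundles using (Equivalence)
open import Data.Product using (_,_; proj₂)
open import Data.Empty using (⊥-elim)
open import Function using (case_of_)
open import Relation.Nullary using (¬_; Dec; yes; no; does; contradiction)
open import Relation.Binary.PropositionalEquality hiding ([_])
open import Data.Rational.Solver using (module +-*-Solver)
open +-*-Solver using (solve; _:=_; _:*_)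
open import Algebra.Bundles using (CommutativeMonoid)
import Algebra.Properties.CommutativeSemigroup as CommSemigroupProperties

-- Binomial coefficients

module _ where
  open import Data.Nat using (_+_; _*_; _≤_)

  nCk*k!*[n∸k]!≡n! : ∀ {n k} → k ≤ n → (n C k) * (k ! * (n ∸ k) !) ≡ n !
  nCk*k!*[n∸k]!≡n! {n} {k} k≤n =
    trans (cong (_* (k ! * (n ∸ k) !)) (nCk≡n!/k![n-k]! k≤n))
          (m/n*n≡m {{k ℕₚ.!* (n ∸ k) !≢0}} (k![n∸k]!∣n! k≤n))

  C*!*!≡! : ∀ {n} a b → a + b ≡ n → (n C a) * (a ! * b !) ≡ n !
  C*!*!≡! a b refl = subst (λ x → ((a + b) C a) * (a ! * x !) ≡ (a + b) !)
    (ℕₚ.m+n∸m≡n a b) (nCk*k!*[n∸k]!≡n! (ℕₚ.m≤m+n a b))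

  C-nonZero : ∀ {n k} → k ≤ n → NonZero (n C k)
  C-nonZero {n} {k} k≤n = ℕₚ.m*n≢0⇒m≢0 (n C k)
    {{subst NonZero (sym (nCk*k!*[n∸k]!≡n! k≤n)) (n ℕₚ.!≢0)}}

  [1+u]*[k+1+u]C[1+u]≡[1+k+u]*[k+u]Cu :
    ∀ k u → suc u * ((k + suc u) C suc u) ≡ suc (k + u) * ((k + u) C u)
  [1+u]*[k+1+u]C[1+u]≡[1+k+u]*[k+u]Cu k u =
    ℕₚ.*-cancelʳ-≡ (suc u * ((k + suc u) C suc u)) (suc (k + u) * ((k + u) C u))
      (u ! * k !) {{u ℕₚ.!* k !≢0}} (begin
      suc u * ((k + suc u) C suc u) * (u ! * k !)
        ≡⟨ shuffle (suc u) ((k + suc u) C suc u) (u !) (k !) ⟩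
      ((k + suc u) C suc u) * (suc u ! * k !)
        ≡⟨ C*!*!≡! (suc u) k (ℕₚ.+-comm (suc u) k) ⟩
      (k + suc u) !
        ≡⟨ cong _! (ℕₚ.+-suc k u) ⟩
      suc (k + u) * (k + u) !
        ≡⟨ cong (suc (k + u) *_) (C*!*!≡! u k (ℕₚ.+-comm u k)) ⟨
      suc (k + u) * (((k + u) C u) * (u ! * k !))
        ≡⟨ ℕₚ.*-assoc (suc (k + u)) ((k + u) C u) (u ! * k !) ⟨
      suc (k + u) * ((k + u) C u) * (u ! * k !) ∎)
    where
    open ≡-Reasoning
    shuffle : ∀ s c x y → s * c * (x * y) ≡ c * (s * x * y)
    shuffle = solve-∀

  [k+[j+p]]+q≡[k+j]+[p+q] : ∀ k j p q → k + (j + p) + q ≡ (k + j) + (p + q)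
  [k+[j+p]]+q≡[k+j]+[p+q] = solve-∀

  [1+u]Cu≡1+u : ∀ u → suc u C u ≡ suc u
  [1+u]Cu≡1+u u = trans (nCk≡nC[n∸k] (ℕₚ.n≤1+n u)) (trans (cong (suc u C_) (ℕₚ.m+n∸n≡m 1 u)) (nC1≡n (suc u)))

  -- Both sides are the multinomial coefficient n! / (k! j! p! q!).
  C-multinomial-swap′ : ∀ k j p q → let n = k + (j + p) + q in
    ((p + q) C p) * ((k + j) C j) * (n C (k + j))
      ≡ ((k + (j + p)) C (j + p)) * ((j + p) C j) * (n C (k + (j + p)))
  C-multinomial-swap′ k j p q =
    ℕₚ.*-cancelʳ-≡ (((p + q) C p) * ((k + j) C j) * (n C (k + j)))
      (((k + (j + p)) C (j + p)) * ((j + p) C j) * (n C (k + (j + p))))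
      D {{D-nonZero}} (trans lhs (sym rhs))
    where
    open ≡-Reasoning
    n D : ℕ
    n = k + (j + p) + q
    D = k ! * j ! * p ! * q !
    D-nonZero : NonZero D
    D-nonZero = ℕₚ.m*n≢0 _ _ {{ℕₚ.m*n≢0 _ _ {{k ℕₚ.!* j !≢0}} {{p ℕₚ.!≢0}}}} {{q ℕₚ.!≢0}}
    lhs : ((p + q) C p) * ((k + j) C j) * (n C (k + j)) * D ≡ n !
    lhs = begin
      ((p + q) C p) * ((k + j) C j) * (n C (k + j)) * D
        ≡⟨ shuffleˡ ((p + q) C p) ((k + j) C j) (n C (k + j)) (k !) (j !) (p !) (q !) ⟩
      (n C (k + j)) * ((((k + j) C j) * (j ! * k !)) * (((p + q) C p) * (p ! * q !)))
        ≡⟨ cong₂ (λ x y → (n C (k + j)) * (x * y))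
             (C*!*!≡! j k (ℕₚ.+-comm j k)) (C*!*!≡! p q refl) ⟩
      (n C (k + j)) * ((k + j) ! * (p + q) !)
        ≡⟨ C*!*!≡! (k + j) (p + q) (sym ([k+[j+p]]+q≡[k+j]+[p+q] k j p q)) ⟩
      n ! ∎
      where
      shuffleˡ : ∀ a b c k! j! p! q! →
        a * b * c * (k! * j! * p! * q!) ≡ c * ((b * (j! * k!)) * (a * (p! * q!)))
      shuffleˡ = solve-∀
    rhs : ((k + (j + p)) C (j + p)) * ((j + p) C j) * (n C (k + (j + p))) * D ≡ n !
    rhs = begin
      ((k + (j + p)) C (j + p)) * ((j + p) C j) * (n C (k + (j + p))) * D
        ≡⟨ shuffleʳ ((k + (j + p)) C (j + p)) ((j + p) C j) (n C (k + (j + p))) (k !) (j !) (p !) (q !) ⟩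
      (n C (k + (j + p))) * ((((k + (j + p)) C (j + p)) * ((((j + p) C j) * (j ! * p !)) * k !)) * q !)
        ≡⟨ cong (λ x → (n C (k + (j + p))) * ((((k + (j + p)) C (j + p)) * (x * k !)) * q !))
             (C*!*!≡! j p refl) ⟩
      (n C (k + (j + p))) * ((((k + (j + p)) C (j + p)) * ((j + p) ! * k !)) * q !)
        ≡⟨ cong (λ x → (n C (k + (j + p))) * (x * q !)) (C*!*!≡! (j + p) k (ℕₚ.+-comm (j + p) k)) ⟩
      (n C (k + (j + p))) * ((k + (j + p)) ! * q !)
        ≡⟨ C*!*!≡! (k + (j + p)) q refl ⟩
      n ! ∎
      where
      shuffleʳ : ∀ a b c k! j! p! q! →
        a * b * c * (k! * j! * p! * q!) ≡ c * ((a * ((b * (j! * p!)) * k!)) * q!)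
      shuffleʳ = solve-∀

  [k+[j+p]+q]∸[k+j]≡p+q : ∀ k j p q → k + (j + p) + q ∸ (k + j) ≡ p + q
  [k+[j+p]+q]∸[k+j]≡p+q k j p q =
    trans (cong (_∸ (k + j)) ([k+[j+p]]+q≡[k+j]+[p+q] k j p q)) (ℕₚ.m+n∸m≡n (k + j) (p + q))

  C-multinomial-swap : ∀ k j u d → j ≤ u → k + u ≤ d →
    ((d ∸ (k + j)) C (u ∸ j)) * ((k + j) C j) * (d C (k + j))
      ≡ ((k + u) C u) * (u C j) * (d C (k + u))
  C-multinomial-swap k j u d j≤u k+u≤d
    with ℕₚ.m≤n⇒∃[o]m+o≡n j≤u | ℕₚ.m≤n⇒∃[o]m+o≡n k+u≤d
  ... | p , refl | q , refl =
    subst₂ (λ x y → (x C y) * ((k + j) C j) * ((k + (j + p) + q) C (k + j))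
                      ≡ ((k + (j + p)) C (j + p)) * ((j + p) C j) * ((k + (j + p) + q) C (k + (j + p))))
      (sym ([k+[j+p]+q]∸[k+j]≡p+q k j p q)) (sym (ℕₚ.m+n∸m≡n j p)) (C-multinomial-swap′ k j p q)

-- Rational arithmetic

module _ where
  open import Data.Rational using (_+_; _*_)
  open ≡-Reasoning

  ℕ→ℚ≡mkℚ : ∀ m → ℕ→ℚ m ≡ mkℚ (ℤ.+ m) 0 (Coprime.sym (Coprime.1-coprimeTo m))
  ℕ→ℚ≡mkℚ m = ℚₚ.normalize-coprime _

  ℕ→ℚ-suc : ∀ m → ℕ→ℚ (suc m) ≡ 1ℚ + ℕ→ℚ m
  ℕ→ℚ-suc m rewrite ℕ→ℚ≡mkℚ m =
    cong (ℚ._/ 1) (cong (ℤ._+_ (ℤ.+ 1)) (sym (ℤₚ.*-identityʳ (ℤ.+ m))))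

  ℕ→ℚ-+ : ∀ a b → ℕ→ℚ (a ℕ.+ b) ≡ ℕ→ℚ a + ℕ→ℚ b
  ℕ→ℚ-+ zero b = sym (ℚₚ.+-identityˡ (ℕ→ℚ b))
  ℕ→ℚ-+ (suc a) b = begin
    ℕ→ℚ (suc (a ℕ.+ b))      ≡⟨ ℕ→ℚ-suc (a ℕ.+ b) ⟩
    1ℚ + ℕ→ℚ (a ℕ.+ b)       ≡⟨ cong (1ℚ +_) (ℕ→ℚ-+ a b) ⟩
    1ℚ + (ℕ→ℚ a + ℕ→ℚ b)     ≡⟨ ℚₚ.+-assoc 1ℚ (ℕ→ℚ a) (ℕ→ℚ b) ⟨
    1ℚ + ℕ→ℚ a + ℕ→ℚ b       ≡⟨ cong (_+ ℕ→ℚ b) (ℕ→ℚ-suc a) ⟨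
    ℕ→ℚ (suc a) + ℕ→ℚ b ∎

  ℕ→ℚ-* : ∀ a b → ℕ→ℚ (a ℕ.* b) ≡ ℕ→ℚ a * ℕ→ℚ b
  ℕ→ℚ-* zero b = sym (ℚₚ.*-zeroˡ (ℕ→ℚ b))
  ℕ→ℚ-* (suc a) b = begin
    ℕ→ℚ (b ℕ.+ a ℕ.* b)        ≡⟨ ℕ→ℚ-+ b (a ℕ.* b) ⟩
    ℕ→ℚ b + ℕ→ℚ (a ℕ.* b)      ≡⟨ cong (ℕ→ℚ b +_) (ℕ→ℚ-* a b) ⟩
    ℕ→ℚ b + ℕ→ℚ a * ℕ→ℚ b      ≡⟨ distrib (ℕ→ℚ a) (ℕ→ℚ b) ⟩
    (1ℚ + ℕ→ℚ a) * ℕ→ℚ b       ≡⟨ cong (_* ℕ→ℚ b) (ℕ→ℚ-suc a) ⟨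
    ℕ→ℚ (suc a) * ℕ→ℚ b ∎
    where
    distrib : ∀ x y → y + x * y ≡ (1ℚ + x) * y
    distrib x y = sym (trans (ℚₚ.*-distribʳ-+ y 1ℚ x) (cong (_+ x * y) (ℚₚ.*-identityˡ y)))

  ℕ→ℚ-≢0 : ∀ m → .{{NonZero m}} → ℕ→ℚ m ≢ 0ℚ
  ℕ→ℚ-≢0 (suc m) eq = case cong ℚ.numerator (trans (sym (ℕ→ℚ≡mkℚ (suc m))) eq) of λ ()

  inv : ℚ → ℚ
  inv q = 1ℚ /' q

  /'≡*inv : ∀ p q → p /' q ≡ p * inv q
  /'≡*inv p q with q ≟ 0ℚ
  ... | yes _ = sym (ℚₚ.*-zeroʳ p)
  ... | no _  = cong (p *_) (sym (ℚₚ.*-identityˡ _))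

  *-inv : ∀ q → q ≢ 0ℚ → q * inv q ≡ 1ℚ
  *-inv q q≢0 with q ≟ 0ℚ
  ... | yes q≡0 = contradiction q≡0 q≢0
  ... | no q≢0  = trans (cong (q *_) (ℚₚ.*-identityˡ _)) (ℚₚ.*-inverseʳ q {{≢-nonZero q≢0}})

  inv-unique : ∀ p q → p * q ≡ 1ℚ → inv p ≡ q
  inv-unique p q pq≡1 = begin
    inv p                ≡⟨ ℚₚ.*-identityʳ (inv p) ⟨
    inv p * 1ℚ           ≡⟨ cong (inv p *_) pq≡1 ⟨
    inv p * (p * q)      ≡⟨ ℚₚ.*-assoc (inv p) p q ⟨
    inv p * p * q        ≡⟨ cong (_* q) (trans (ℚₚ.*-comm (inv p) p) (*-inv p p≢0)) ⟩
    1ℚ * q               ≡⟨ ℚₚ.*-identityˡ q ⟩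
    q ∎
    where
    p≢0 : p ≢ 0ℚ
    p≢0 refl = ℚₚ.1≢0 (trans (sym pq≡1) (ℚₚ.*-zeroˡ q))

  inv-* : ∀ p q → inv (p * q) ≡ inv p * inv q
  inv-* p q = cases (p ≟ 0ℚ) (q ≟ 0ℚ)
    where
    shuffle : ∀ p q p′ q′ → p * q * (p′ * q′) ≡ (p * p′) * (q * q′)
    shuffle = CommSemigroupProperties.interchange
      (CommutativeMonoid.commutativeSemigroup ℚₚ.*-1-commutativeMonoid)
    cases : Dec (p ≡ 0ℚ) → Dec (q ≡ 0ℚ) → inv (p * q) ≡ inv p * inv q
    cases (yes refl) _ = trans (cong inv (ℚₚ.*-zeroˡ q)) (sym (ℚₚ.*-zeroˡ (inv q)))
    cases (no _) (yes refl) = trans (cong inv (ℚₚ.*-zeroʳ p)) (sym (ℚₚ.*-zeroʳ (inv p)))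
    cases (no p≢0) (no q≢0) = inv-unique (p * q) (inv p * inv q) (begin
      p * q * (inv p * inv q)          ≡⟨ shuffle p q (inv p) (inv q) ⟩
      (p * inv p) * (q * inv q)        ≡⟨ cong₂ _*_ (*-inv p p≢0) (*-inv q q≢0) ⟩
      1ℚ * 1ℚ                          ≡⟨ ℚₚ.*-identityˡ 1ℚ ⟩
      1ℚ ∎)

  *-inv-cancelʳ : ∀ p q → q ≢ 0ℚ → p * inv q * q ≡ p
  *-inv-cancelʳ p q q≢0 = begin
    p * inv q * q      ≡⟨ ℚₚ.*-assoc p (inv q) q ⟩
    p * (inv q * q)    ≡⟨ cong (p *_) (trans (ℚₚ.*-comm (inv q) q) (*-inv q q≢0)) ⟩
    p * 1ℚ             ≡⟨ ℚₚ.*-identityʳ p ⟩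
    p ∎

  *-inv-cancelˡ : ∀ p q → p ≢ 0ℚ → p * inv (p * q) ≡ inv q
  *-inv-cancelˡ p q p≢0 = begin
    p * inv (p * q)        ≡⟨ cong (p *_) (inv-* p q) ⟩
    p * (inv p * inv q)    ≡⟨ ℚₚ.*-assoc p (inv p) (inv q) ⟨
    p * inv p * inv q      ≡⟨ cong (_* inv q) (*-inv p p≢0) ⟩
    1ℚ * inv q             ≡⟨ ℚₚ.*-identityˡ (inv q) ⟩
    inv q ∎

module _ where
  open import Data.Nat using (_+_; _≤_)
  open import Data.Rational using (_*_)
  open ≡-Reasoning

  C-absorption-inv : ∀ k u Q →
    ℕ→ℚ (suc u) * (inv (ℕ→ℚ (suc (k + u))) * inv (ℕ→ℚ ((k + u) C u) * Q))
      ≡ inv (ℕ→ℚ ((k + suc u) C suc u) * Q)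
  C-absorption-inv k u Q = begin
    S * (inv N * inv (Cku * Q))     ≡⟨ cong (S *_) (inv-* N (Cku * Q)) ⟨
    S * inv (N * (Cku * Q))         ≡⟨ cong (λ x → S * inv x) (ℚₚ.*-assoc N Cku Q) ⟨
    S * inv (N * Cku * Q)           ≡⟨ cong (λ x → S * inv (x * Q)) N*Cku≡S*C′ ⟩
    S * inv (S * C′ * Q)            ≡⟨ cong (λ x → S * inv x) (ℚₚ.*-assoc S C′ Q) ⟩
    S * inv (S * (C′ * Q))          ≡⟨ *-inv-cancelˡ S (C′ * Q) (ℕ→ℚ-≢0 (suc u)) ⟩
    inv (C′ * Q) ∎
    where
    N S Cku C′ : ℚ
    N   = ℕ→ℚ (suc (k + u))
    S   = ℕ→ℚ (suc u)
    Cku = ℕ→ℚ ((k + u) C u)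
    C′  = ℕ→ℚ ((k + suc u) C suc u)
    N*Cku≡S*C′ : N * Cku ≡ S * C′
    N*Cku≡S*C′ = begin
      N * Cku                                      ≡⟨ ℕ→ℚ-* (suc (k + u)) ((k + u) C u) ⟨
      ℕ→ℚ (suc (k + u) ℕ.* ((k + u) C u))          ≡⟨ cong ℕ→ℚ ([1+u]*[k+1+u]C[1+u]≡[1+k+u]*[k+u]Cu k u) ⟨
      ℕ→ℚ (suc u ℕ.* ((k + suc u) C suc u))        ≡⟨ ℕ→ℚ-* (suc u) ((k + suc u) C suc u) ⟩
      S * C′ ∎

  C-multinomial-swap-inv : ∀ k j u d → j ≤ u → k + u ≤ d →
    ℕ→ℚ ((d ∸ (k + j)) C (u ∸ j)) * inv (ℕ→ℚ ((k + u) C u) * ℕ→ℚ (u C j) * ℕ→ℚ (d C (k + u)))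
      ≡ inv (ℕ→ℚ ((k + j) C j)) * inv (ℕ→ℚ (d C (k + j)))
  C-multinomial-swap-inv k j u d j≤u k+u≤d = begin
    cb * inv (Cmu * Cuj * Dm)      ≡⟨ cong (λ x → cb * inv x) cb*ckj*dkj≡Cmu*Cuj*Dm ⟨
    cb * inv (cb * ckj * dkj)      ≡⟨ cong (λ x → cb * inv x) (ℚₚ.*-assoc cb ckj dkj) ⟩
    cb * inv (cb * (ckj * dkj))    ≡⟨ *-inv-cancelˡ cb (ckj * dkj) cb≢0 ⟩
    inv (ckj * dkj)                ≡⟨ inv-* ckj dkj ⟩
    inv ckj * inv dkj ∎
    where
    cb ckj dkj Cmu Cuj Dm : ℚ
    cb  = ℕ→ℚ ((d ∸ (k + j)) C (u ∸ j))
    ckj = ℕ→ℚ ((k + j) C j)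
    dkj = ℕ→ℚ (d C (k + j))
    Cmu = ℕ→ℚ ((k + u) C u)
    Cuj = ℕ→ℚ (u C j)
    Dm  = ℕ→ℚ (d C (k + u))
    cb≢0 : cb ≢ 0ℚ
    cb≢0 = ℕ→ℚ-≢0 ((d ∸ (k + j)) C (u ∸ j)) {{C-nonZero u∸j≤d∸[k+j]}}
      where
      u∸j≤d∸[k+j] : u ∸ j ≤ d ∸ (k + j)
      u∸j≤d∸[k+j] = subst (_≤ d ∸ (k + j)) (ℕₚ.[m+n]∸[m+o]≡n∸o k u j) (ℕₚ.∸-monoˡ-≤ (k + j) k+u≤d)
    cb*ckj*dkj≡Cmu*Cuj*Dm : cb * ckj * dkj ≡ Cmu * Cuj * Dm
    cb*ckj*dkj≡Cmu*Cuj*Dm = begin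
      cb * ckj * dkj
        ≡⟨ cong (_* dkj) (ℕ→ℚ-* ((d ∸ (k + j)) C (u ∸ j)) ((k + j) C j)) ⟨
      ℕ→ℚ (((d ∸ (k + j)) C (u ∸ j)) ℕ.* ((k + j) C j)) * dkj
        ≡⟨ ℕ→ℚ-* (((d ∸ (k + j)) C (u ∸ j)) ℕ.* ((k + j) C j)) (d C (k + j)) ⟨
      ℕ→ℚ (((d ∸ (k + j)) C (u ∸ j)) ℕ.* ((k + j) C j) ℕ.* (d C (k + j)))
        ≡⟨ cong ℕ→ℚ (C-multinomial-swap k j u d j≤u k+u≤d) ⟩
      ℕ→ℚ (((k + u) C u) ℕ.* (u C j) ℕ.* (d C (k + u)))
        ≡⟨ ℕ→ℚ-* (((k + u) C u) ℕ.* (u C j)) (d C (k + u)) ⟩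
      ℕ→ℚ (((k + u) C u) ℕ.* (u C j)) * Dm
        ≡⟨ cong (_* Dm) (ℕ→ℚ-* ((k + u) C u) (u C j)) ⟩
      Cmu * Cuj * Dm ∎

  -- The constants of the swapping walk; c stands for C(k, l − j) and Q for Π_k(s).
  C-swap-constants : ∀ k j u d (c w Q : ℚ) → j ≤ u → k + u ≤ d →
    ℕ→ℚ ((d ∸ (k + j)) C (u ∸ j)) * w
      * (inv (ℕ→ℚ (d C (k + u))) * (inv (ℕ→ℚ ((k + u) C u) * Q) * inv (c * ℕ→ℚ (u C j))))
      ≡ inv (c * ℕ→ℚ ((k + j) C j)) * (w * inv (ℕ→ℚ (d C (k + j))) * inv Q)
  C-swap-constants k j u d c w Q j≤u k+u≤d = begin
    cb * w * (inv Dm * (inv (Cmu * Q) * inv (c * Cuj)))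
      ≡⟨ cong₂ (λ x y → cb * w * (inv Dm * (x * y))) (inv-* Cmu Q) (inv-* c Cuj) ⟩
    cb * w * (inv Dm * ((inv Cmu * inv Q) * (inv c * inv Cuj)))
      ≡⟨ shuffleˡ cb w (inv Dm) (inv Cmu) (inv Q) (inv c) (inv Cuj) ⟩
    w * inv Q * inv c * (cb * (inv Cmu * inv Cuj * inv Dm))
      ≡⟨ cong (λ x → w * inv Q * inv c * (cb * (x * inv Dm))) (inv-* Cmu Cuj) ⟨
    w * inv Q * inv c * (cb * (inv (Cmu * Cuj) * inv Dm))
      ≡⟨ cong (λ x → w * inv Q * inv c * (cb * x)) (inv-* (Cmu * Cuj) Dm) ⟨
    w * inv Q * inv c * (cb * inv (Cmu * Cuj * Dm))
      ≡⟨ cong (w * inv Q * inv c *_) (C-multinomial-swap-inv k j u d j≤u k+u≤d) ⟩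
    w * inv Q * inv c * (inv ckj * inv dkj)
      ≡⟨ shuffleʳ w (inv Q) (inv c) (inv ckj) (inv dkj) ⟩
    inv c * inv ckj * (w * inv dkj * inv Q)
      ≡⟨ cong (_* (w * inv dkj * inv Q)) (inv-* c ckj) ⟨
    inv (c * ckj) * (w * inv dkj * inv Q) ∎
    where
    cb ckj dkj Cmu Cuj Dm : ℚ
    cb  = ℕ→ℚ ((d ∸ (k + j)) C (u ∸ j))
    ckj = ℕ→ℚ ((k + j) C j)
    dkj = ℕ→ℚ (d C (k + j))
    Cmu = ℕ→ℚ ((k + u) C u)
    Cuj = ℕ→ℚ (u C j)
    Dm  = ℕ→ℚ (d C (k + u))
    shuffleˡ : ∀ c w a b q e f → c * w * (a * ((b * q) * (e * f))) ≡ w * q * e * (c * (b * f * a))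
    shuffleˡ = solve 7 (λ c w a b q e f → c :* w :* (a :* ((b :* q) :* (e :* f))) := w :* q :* e :* (c :* (b :* f :* a))) refl
    shuffleʳ : ∀ w q e x y → w * q * e * (x * y) ≡ e * x * (w * y * q)
    shuffleʳ = solve 5 (λ w q e x y → w :* q :* e :* (x :* y) := e :* x :* (w :* y :* q)) refl

-- Finite sums and counting

-- Σsub f and the denominator of Swalk unfold to ∑ (allSubsets n) f and count, so the
-- lemmas below apply to them as they stand.
module _ {A : Set} where
  open import Data.Rational using (_+_; _*_; _≤_)
  open ≡-Reasoning

  ∑ : List A → (A → ℚ) → ℚ
  ∑ xs f = foldr (λ x acc → f x + acc) 0ℚ xs

  ∑-cong : ∀ xs {f g : A → ℚ} → (∀ x → f x ≡ g x) → ∑ xs f ≡ ∑ xs g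
  ∑-cong []       f≗g = refl
  ∑-cong (x ∷ xs) f≗g = cong₂ _+_ (f≗g x) (∑-cong xs f≗g)

  ∑-zero : ∀ xs → ∑ xs (λ _ → 0ℚ) ≡ 0ℚ
  ∑-zero []       = refl
  ∑-zero (x ∷ xs) = trans (ℚₚ.+-identityˡ _) (∑-zero xs)

  ∑-+ : ∀ xs (f g : A → ℚ) → ∑ xs (λ x → f x + g x) ≡ ∑ xs f + ∑ xs g
  ∑-+ []       f g = sym (ℚₚ.+-identityˡ 0ℚ)
  ∑-+ (x ∷ xs) f g = trans (cong (f x + g x +_) (∑-+ xs f g)) (interchange (f x) (g x) (∑ xs f) (∑ xs g))
    where
    interchange : ∀ a b c d → (a + b) + (c + d) ≡ (a + c) + (b + d)
    interchange = CommSemigroupProperties.interchange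
      (CommutativeMonoid.commutativeSemigroup ℚₚ.+-0-commutativeMonoid)

  ∑-*ˡ : ∀ xs c (f : A → ℚ) → ∑ xs (λ x → c * f x) ≡ c * ∑ xs f
  ∑-*ˡ []       c f = sym (ℚₚ.*-zeroʳ c)
  ∑-*ˡ (x ∷ xs) c f = trans (cong (c * f x +_) (∑-*ˡ xs c f)) (sym (ℚₚ.*-distribˡ-+ c (f x) _))

  ∑-*ʳ : ∀ xs c (f : A → ℚ) → ∑ xs (λ x → f x * c) ≡ ∑ xs f * c
  ∑-*ʳ xs c f = begin
    ∑ xs (λ x → f x * c)   ≡⟨ ∑-cong xs (λ x → ℚₚ.*-comm (f x) c) ⟩
    ∑ xs (λ x → c * f x)   ≡⟨ ∑-*ˡ xs c f ⟩
    c * ∑ xs f             ≡⟨ ℚₚ.*-comm c (∑ xs f) ⟩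
    ∑ xs f * c ∎

  ∑-mono-≤ : ∀ xs {f g : A → ℚ} → (∀ x → f x ≤ g x) → ∑ xs f ≤ ∑ xs g
  ∑-mono-≤ []       f≤g = ℚₚ.≤-refl
  ∑-mono-≤ (x ∷ xs) f≤g = ℚₚ.+-mono-≤ (f≤g x) (∑-mono-≤ xs f≤g)

  ∑-nonneg : ∀ xs {f : A → ℚ} → (∀ x → 0ℚ ≤ f x) → 0ℚ ≤ ∑ xs f
  ∑-nonneg xs {f} 0≤f = subst (_≤ ∑ xs f) (∑-zero xs) (∑-mono-≤ xs 0≤f)

  count : (A → Bool) → List A → ℕ
  count P xs = length (filter (λ x → P x Bool.≟ true) xs)

  count-++ : ∀ P xs ys → count P (xs ++ ys) ≡ count P xs ℕ.+ count P ys
  count-++ P []       ys = refl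
  count-++ P (x ∷ xs) ys with P x
  ... | true  = cong suc (count-++ P xs ys)
  ... | false = count-++ P xs ys

  count-cong : ∀ {P Q} xs → (∀ x → P x ≡ Q x) → count P xs ≡ count Q xs
  count-cong {P} {Q} []       P≗Q = refl
  count-cong {P} {Q} (x ∷ xs) P≗Q rewrite P≗Q x with Q x
  ... | true  = cong suc (count-cong xs P≗Q)
  ... | false = count-cong xs P≗Q

  count-false : ∀ {P} xs → (∀ x → P x ≡ false) → count P xs ≡ 0
  count-false []       P≡false = refl
  count-false (x ∷ xs) P≡false rewrite P≡false x = count-false xs P≡false

  ∑-indicator : ∀ P xs → ∑ xs (λ x → [ P x ]) ≡ ℕ→ℚ (count P xs)
  ∑-indicator P []       = refl
  ∑-indicator P (x ∷ xs) with P x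
  ... | true  = trans (cong (1ℚ +_) (∑-indicator P xs)) (sym (ℕ→ℚ-suc (count P xs)))
  ... | false = trans (ℚₚ.+-identityˡ _) (∑-indicator P xs)

count-map : ∀ {A B : Set} P (g : A → B) xs → count P (map g xs) ≡ count (λ x → P (g x)) xs
count-map P g []       = refl
count-map P g (x ∷ xs) with P (g x)
... | true  = cong suc (count-map P g xs)
... | false = count-map P g xs

∑-swap : ∀ {A B : Set} xs ys (f : A → B → ℚ) →
  ∑ xs (λ x → ∑ ys (f x)) ≡ ∑ ys (λ y → ∑ xs (λ x → f x y))
∑-swap []       ys f = sym (∑-zero ys)
∑-swap (x ∷ xs) ys f =
  trans (cong (∑ ys (f x) ℚ.+_) (∑-swap xs ys f)) (sym (∑-+ ys (f x) (λ y → ∑ xs (λ x → f x y))))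

count-allSubsets-suc : ∀ {n} (P : Subset (suc n) → Bool) →
  count P (allSubsets (suc n))
    ≡ count (λ p → P (outside ∷ p)) (allSubsets n) ℕ.+ count (λ p → P (inside ∷ p)) (allSubsets n)
count-allSubsets-suc {n} P = trans (count-++ P (map (outside ∷_) (allSubsets n)) _)
  (cong₂ ℕ._+_ (count-map P (outside ∷_) (allSubsets n)) (count-map P (inside ∷_) (allSubsets n)))

[b]*q-nonneg : ∀ b {q} → 0ℚ ℚ.≤ q → 0ℚ ℚ.≤ [ b ] ℚ.* q
[b]*q-nonneg true  {q} 0≤q = subst (0ℚ ℚ.≤_) (sym (ℚₚ.*-identityˡ q)) 0≤q
[b]*q-nonneg false {q} _   = ℚₚ.≤-reflexive (sym (ℚₚ.*-zeroˡ q))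

[a]*[[b]*q]≡[a∧b]*q : ∀ a b q → [ a ] ℚ.* ([ b ] ℚ.* q) ≡ [ a ∧ b ] ℚ.* q
[a]*[[b]*q]≡[a∧b]*q true  b q = ℚₚ.*-identityˡ ([ b ] ℚ.* q)
[a]*[[b]*q]≡[a∧b]*q false b q = trans (ℚₚ.*-zeroˡ ([ b ] ℚ.* q)) (sym (ℚₚ.*-zeroˡ q))

-- Subsets

module _ where
  open import Data.Nat using (_+_; _*_; _≤_)

  x∧y∧false≡false : ∀ x y → x ∧ y ∧ false ≡ false
  x∧y∧false≡false x y = trans (cong (x ∧_) (Boolₚ.∧-zeroʳ y)) (Boolₚ.∧-zeroʳ x)

  ≡ᵇ⇒≡ : ∀ {m n} → (m ℕ.≡ᵇ n) ≡ true → m ≡ n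
  ≡ᵇ⇒≡ {m} {n} eq = ℕₚ.≡ᵇ⇒≡ m n (subst T (sym eq) _)

  ≡⇒≡ᵇ : ∀ {m n} → m ≡ n → (m ℕ.≡ᵇ n) ≡ true
  ≡⇒≡ᵇ {m} {n} eq = Equivalence.to Boolₚ.T-≡ (ℕₚ.≡⇒≡ᵇ m n eq)

  ≢⇒≡ᵇ : ∀ {m n} → m ≢ n → (m ℕ.≡ᵇ n) ≡ false
  ≢⇒≡ᵇ {m} {n} m≢n with m ℕ.≡ᵇ n in eq
  ... | true  = contradiction (≡ᵇ⇒≡ eq) m≢n
  ... | false = refl

  [a+x≡ᵇa+y]≡[x≡ᵇy] : ∀ a x y → ((a + x) ℕ.≡ᵇ (a + y)) ≡ (x ℕ.≡ᵇ y)
  [a+x≡ᵇa+y]≡[x≡ᵇy] zero    x y = refl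
  [a+x≡ᵇa+y]≡[x≡ᵇy] (suc a) x y = [a+x≡ᵇa+y]≡[x≡ᵇy] a x y

  C-pascal : ∀ m e → m C suc e + m C e ≡ suc m C suc e
  C-pascal m e = trans (ℕₚ.+-comm (m C suc e) (m C e)) (nCk+nC[k+1]≡[n+1]C[k+1] m e)

  ∣q∣≡∣p∣+∣q─p∣ : ∀ {n} {p q : Subset n} → p ⊆ q → ∣ q ∣ ≡ ∣ p ∣ + ∣ q ─ p ∣
  ∣q∣≡∣p∣+∣q─p∣ {p = []}          {[]}          p⊆q = refl
  ∣q∣≡∣p∣+∣q─p∣ {p = outside ∷ p} {outside ∷ q} p⊆q = ∣q∣≡∣p∣+∣q─p∣ (drop-∷-⊆ p⊆q)
  ∣q∣≡∣p∣+∣q─p∣ {p = outside ∷ p} {inside ∷ q}  p⊆q =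
    trans (cong suc (∣q∣≡∣p∣+∣q─p∣ (drop-∷-⊆ p⊆q))) (sym (ℕₚ.+-suc ∣ p ∣ _))
  ∣q∣≡∣p∣+∣q─p∣ {p = inside ∷ p}  {outside ∷ q} p⊆q = case p⊆q here of λ ()
  ∣q∣≡∣p∣+∣q─p∣ {p = inside ∷ p}  {inside ∷ q}  p⊆q = cong suc (∣q∣≡∣p∣+∣q─p∣ (drop-∷-⊆ p⊆q))

  p⊆q∧∣q∣≡k+e⇒∣q─p∣≡e : ∀ {n k e} {p q : Subset n} → p ⊆ q → ∣ p ∣ ≡ k → ∣ q ∣ ≡ k + e → ∣ q ─ p ∣ ≡ e
  p⊆q∧∣q∣≡k+e⇒∣q─p∣≡e {k = k} {q = q} p⊆q refl ∣q∣≡k+e =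
    ℕₚ.+-cancelˡ-≡ k _ _ (trans (sym (∣q∣≡∣p∣+∣q─p∣ p⊆q)) ∣q∣≡k+e)

  ∣p─q∣≡0⇒p⊆q : ∀ {n} (p q : Subset n) → ∣ p ─ q ∣ ≡ 0 → p ⊆ q
  ∣p─q∣≡0⇒p⊆q []            []            _  = λ ()
  ∣p─q∣≡0⇒p⊆q (outside ∷ p) (outside ∷ q) eq = out⊆ (∣p─q∣≡0⇒p⊆q p q eq)
  ∣p─q∣≡0⇒p⊆q (outside ∷ p) (inside ∷ q)  eq = out⊆ (∣p─q∣≡0⇒p⊆q p q eq)
  ∣p─q∣≡0⇒p⊆q (inside ∷ p)  (inside ∷ q)  eq = in⊆in (∣p─q∣≡0⇒p⊆q p q eq)

  between : ∀ {n} → Subset n → Subset n → ℕ → Subset n → Bool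
  between b f e c = ⊆ᵇ b c ∧ ⊆ᵇ c f ∧ (∣ c ─ b ∣ ℕ.≡ᵇ e)

  count-between : ∀ {n} (b f : Subset n) e → b ⊆ f →
    count (between b f e) (allSubsets n) ≡ ∣ f ─ b ∣ C e
  count-between []            []            zero    _   = refl
  count-between []            []            (suc e) _   = refl
  count-between (outside ∷ b) (outside ∷ f) e       b⊆f =
    trans (count-allSubsets-suc (between (outside ∷ b) (outside ∷ f) e))
      (trans (cong₂ _+_ (count-between b f e (drop-∷-⊆ b⊆f))
                        (count-false (allSubsets _) (λ c → Boolₚ.∧-zeroʳ (⊆ᵇ b c))))
             (ℕₚ.+-identityʳ _))
  count-between (outside ∷ b) (inside ∷ f)  zero    b⊆f =
    trans (count-allSubsets-suc (between (outside ∷ b) (inside ∷ f) zero))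
      (trans (cong₂ _+_ (count-between b f zero (drop-∷-⊆ b⊆f))
                        (count-false (allSubsets _) (λ c → x∧y∧false≡false (⊆ᵇ b c) (⊆ᵇ c f))))
             (ℕₚ.+-identityʳ _))
  count-between (outside ∷ b) (inside ∷ f)  (suc e) b⊆f =
    trans (count-allSubsets-suc (between (outside ∷ b) (inside ∷ f) (suc e)))
      (trans (cong₂ _+_ (count-between b f (suc e) (drop-∷-⊆ b⊆f)) (count-between b f e (drop-∷-⊆ b⊆f)))
             (C-pascal ∣ f ─ b ∣ e))
  count-between (inside ∷ b)  (outside ∷ f) e       b⊆f = case b⊆f here of λ ()
  count-between (inside ∷ b)  (inside ∷ f)  e       b⊆f =
    trans (count-allSubsets-suc (between (inside ∷ b) (inside ∷ f) e))
      (cong₂ _+_ (count-false {P = λ c → between (inside ∷ b) (inside ∷ f) e (outside ∷ c)} (allSubsets _)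
                              (λ _ → refl))
                 (count-between b f e (drop-∷-⊆ b⊆f)))

  count-between-⊈ : ∀ {n} {b f : Subset n} e → ¬ b ⊆ f → count (between b f e) (allSubsets n) ≡ 0
  count-between-⊈ {n} {b} {f} e b⊈f = count-false (allSubsets n) excluded
    where
    excluded : ∀ c → between b f e c ≡ false
    excluded c with b ⊆? c | c ⊆? f
    ... | yes b⊆c | yes c⊆f = ⊥-elim (b⊈f (⊆-trans b⊆c c⊆f))
    ... | yes _   | no _    = refl
    ... | no _    | _       = refl

  ⊆ᵇ-true : ∀ {n} {p q : Subset n} → p ⊆ q → ⊆ᵇ p q ≡ true
  ⊆ᵇ-true {p = p} {q} p⊆q with p ⊆? q
  ... | yes _   = refl
  ... | no p⊈q = ⊥-elim (p⊈q p⊆q)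

  ⊆ᵇ-false : ∀ {n} {p q : Subset n} → ¬ p ⊆ q → ⊆ᵇ p q ≡ false
  ⊆ᵇ-false {p = p} {q} p⊈q with p ⊆? q
  ... | yes p⊆q = ⊥-elim (p⊈q p⊆q)
  ... | no _    = refl

  ∪-⊆ : ∀ {n} {p q r : Subset n} → p ⊆ r → q ⊆ r → p ∪ q ⊆ r
  ∪-⊆ {p = p} {q} p⊆r q⊆r x∈p∪q = Sum.[ p⊆r , q⊆r ] (x∈p∪q⁻ p q x∈p∪q)

  ∣p∪q∣≡∣p∣+∣q∣ : ∀ {n} (p q : Subset n) → Empty (q ∩ p) → ∣ p ∪ q ∣ ≡ ∣ p ∣ + ∣ q ∣
  ∣p∪q∣≡∣p∣+∣q∣ []            []            _     = refl
  ∣p∪q∣≡∣p∣+∣q∣ (outside ∷ p) (outside ∷ q) empty = ∣p∪q∣≡∣p∣+∣q∣ p q (drop-∷-Empty empty)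
  ∣p∪q∣≡∣p∣+∣q∣ (outside ∷ p) (inside ∷ q)  empty =
    trans (cong suc (∣p∪q∣≡∣p∣+∣q∣ p q (drop-∷-Empty empty))) (sym (ℕₚ.+-suc ∣ p ∣ ∣ q ∣))
  ∣p∪q∣≡∣p∣+∣q∣ (inside ∷ p)  (outside ∷ q) empty = cong suc (∣p∪q∣≡∣p∣+∣q∣ p q (drop-∷-Empty empty))
  ∣p∪q∣≡∣p∣+∣q∣ (inside ∷ p)  (inside ∷ q)  empty = ⊥-elim (empty (Fin.zero , here))

  ∣t∣≡∣t∩s∣+∣t∩[c─s]∣ : ∀ {n} (t c s : Subset n) → t ⊆ c → ∣ t ∣ ≡ ∣ t ∩ s ∣ + ∣ t ∩ (c ─ s) ∣
  ∣t∣≡∣t∩s∣+∣t∩[c─s]∣ []            []            []            _   = refl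
  ∣t∣≡∣t∩s∣+∣t∩[c─s]∣ (outside ∷ t) (_ ∷ c)       (_ ∷ s)       t⊆c = ∣t∣≡∣t∩s∣+∣t∩[c─s]∣ t c s (drop-∷-⊆ t⊆c)
  ∣t∣≡∣t∩s∣+∣t∩[c─s]∣ (inside ∷ t)  (outside ∷ c) (_ ∷ s)       t⊆c = case t⊆c here of λ ()
  ∣t∣≡∣t∩s∣+∣t∩[c─s]∣ (inside ∷ t)  (inside ∷ c)  (inside ∷ s)  t⊆c =
    cong suc (∣t∣≡∣t∩s∣+∣t∩[c─s]∣ t c s (drop-∷-⊆ t⊆c))
  ∣t∣≡∣t∩s∣+∣t∩[c─s]∣ (inside ∷ t)  (inside ∷ c)  (outside ∷ s) t⊆c =
    trans (cong suc (∣t∣≡∣t∩s∣+∣t∩[c─s]∣ t c s (drop-∷-⊆ t⊆c))) (sym (ℕₚ.+-suc ∣ t ∩ s ∣ _))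

  [s′∪t′]∩[c─s]≡t′ : ∀ {n} (s′ s t′ c : Subset n) → s′ ⊆ s → Empty (t′ ∩ s) → t′ ⊆ c →
    (s′ ∪ t′) ∩ (c ─ s) ≡ t′
  [s′∪t′]∩[c─s]≡t′ [] [] [] [] _ _ _ = refl
  [s′∪t′]∩[c─s]≡t′ (outside ∷ s′) (outside ∷ s) (outside ∷ t′) (_ ∷ c) s′⊆s empty t′⊆c =
    cong (outside ∷_) ([s′∪t′]∩[c─s]≡t′ s′ s t′ c (drop-∷-⊆ s′⊆s) (drop-∷-Empty empty) (drop-∷-⊆ t′⊆c))
  [s′∪t′]∩[c─s]≡t′ (outside ∷ s′) (outside ∷ s) (inside ∷ t′) (inside ∷ c) s′⊆s empty t′⊆c =
    cong (inside ∷_) ([s′∪t′]∩[c─s]≡t′ s′ s t′ c (drop-∷-⊆ s′⊆s) (drop-∷-Empty empty) (drop-∷-⊆ t′⊆c))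
  [s′∪t′]∩[c─s]≡t′ (outside ∷ s′) (outside ∷ s) (inside ∷ t′) (outside ∷ c) _ _ t′⊆c =
    case t′⊆c here of λ ()
  [s′∪t′]∩[c─s]≡t′ (inside ∷ s′) (outside ∷ s) _ _ s′⊆s _ _ = case s′⊆s here of λ ()
  [s′∪t′]∩[c─s]≡t′ (outside ∷ s′) (inside ∷ s) (outside ∷ t′) (_ ∷ c) s′⊆s empty t′⊆c =
    cong (outside ∷_) ([s′∪t′]∩[c─s]≡t′ s′ s t′ c (drop-∷-⊆ s′⊆s) (drop-∷-Empty empty) (drop-∷-⊆ t′⊆c))
  [s′∪t′]∩[c─s]≡t′ (inside ∷ s′) (inside ∷ s) (outside ∷ t′) (_ ∷ c) s′⊆s empty t′⊆c =
    cong (outside ∷_) ([s′∪t′]∩[c─s]≡t′ s′ s t′ c (drop-∷-⊆ s′⊆s) (drop-∷-Empty empty) (drop-∷-⊆ t′⊆c))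
  [s′∪t′]∩[c─s]≡t′ (_ ∷ s′) (inside ∷ s) (inside ∷ t′) _ _ empty _ = ⊥-elim (empty (Fin.zero , here))

  sized-superset∧⊆≡between : ∀ {n} (b c f : Subset n) e m → m ≡ ∣ b ∣ + e →
    (⊆ᵇ b c ∧ (∣ c ∣ ℕ.≡ᵇ m)) ∧ ⊆ᵇ c f ≡ between b f e c
  sized-superset∧⊆≡between b c f e m m≡∣b∣+e with b ⊆? c
  ... | no _    = refl
  ... | yes b⊆c = begin
    (∣ c ∣ ℕ.≡ᵇ m) ∧ ⊆ᵇ c f                          ≡⟨ cong₂ (λ x y → (x ℕ.≡ᵇ y) ∧ ⊆ᵇ c f) (∣q∣≡∣p∣+∣q─p∣ b⊆c) m≡∣b∣+e ⟩
    ((∣ b ∣ + ∣ c ─ b ∣) ℕ.≡ᵇ (∣ b ∣ + e)) ∧ ⊆ᵇ c f  ≡⟨ cong (_∧ ⊆ᵇ c f) ([a+x≡ᵇa+y]≡[x≡ᵇy] ∣ b ∣ ∣ c ─ b ∣ e) ⟩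
    (∣ c ─ b ∣ ℕ.≡ᵇ e) ∧ ⊆ᵇ c f                      ≡⟨ Boolₚ.∧-comm (∣ c ─ b ∣ ℕ.≡ᵇ e) (⊆ᵇ c f) ⟩
    ⊆ᵇ c f ∧ (∣ c ─ b ∣ ℕ.≡ᵇ e) ∎
    where open ≡-Reasoning

  splits : ∀ {n} → Subset n → Subset n → ℕ → ℕ → Subset n → Bool
  splits s c a j t = ⊆ᵇ t c ∧ (∣ t ∩ s ∣ ℕ.≡ᵇ a) ∧ (∣ t ∩ (c ─ s) ∣ ℕ.≡ᵇ j)

  count-splits : ∀ {n} (s c : Subset n) a j → s ⊆ c →
    count (splits s c a j) (allSubsets n) ≡ (∣ s ∣ C a) * (∣ c ─ s ∣ C j)
  count-splits []            []            zero    zero    _   = refl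
  count-splits []            []            zero    (suc j) _   = refl
  count-splits []            []            (suc a) zero    _   = refl
  count-splits []            []            (suc a) (suc j) _   = refl
  count-splits (outside ∷ s) (outside ∷ c) a       j       s⊆c =
    trans (count-allSubsets-suc (splits (outside ∷ s) (outside ∷ c) a j))
      (trans (cong₂ _+_ (count-splits s c a j (drop-∷-⊆ s⊆c))
                        (count-false {P = λ t → splits (outside ∷ s) (outside ∷ c) a j (inside ∷ t)}
                                     (allSubsets _) (λ _ → refl)))
             (ℕₚ.+-identityʳ _))
  count-splits (outside ∷ s) (inside ∷ c)  a       zero    s⊆c =
    trans (count-allSubsets-suc (splits (outside ∷ s) (inside ∷ c) a zero))
      (trans (cong₂ _+_ (count-splits s c a zero (drop-∷-⊆ s⊆c))
                        (count-false (allSubsets _)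
                                     (λ t → x∧y∧false≡false (⊆ᵇ t c) (∣ t ∩ s ∣ ℕ.≡ᵇ a))))
             (ℕₚ.+-identityʳ _))
  count-splits (outside ∷ s) (inside ∷ c)  a       (suc j) s⊆c =
    trans (count-allSubsets-suc (splits (outside ∷ s) (inside ∷ c) a (suc j)))
      (trans (cong₂ _+_ (count-splits s c a (suc j) (drop-∷-⊆ s⊆c)) (count-splits s c a j (drop-∷-⊆ s⊆c)))
        (trans (sym (ℕₚ.*-distribˡ-+ (∣ s ∣ C a) (∣ c ─ s ∣ C suc j) (∣ c ─ s ∣ C j)))
               (cong ((∣ s ∣ C a) *_) (C-pascal ∣ c ─ s ∣ j))))
  count-splits (inside ∷ s)  (outside ∷ c) a       j       s⊆c = case s⊆c here of λ ()
  count-splits (inside ∷ s)  (inside ∷ c)  zero    j       s⊆c =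
    trans (count-allSubsets-suc (splits (inside ∷ s) (inside ∷ c) zero j))
      (trans (cong₂ _+_ (count-splits s c zero j (drop-∷-⊆ s⊆c))
                        (count-false (allSubsets _) (λ t → Boolₚ.∧-zeroʳ (⊆ᵇ t c))))
             (ℕₚ.+-identityʳ _))
  count-splits (inside ∷ s)  (inside ∷ c)  (suc a) j       s⊆c =
    trans (count-allSubsets-suc (splits (inside ∷ s) (inside ∷ c) (suc a) j))
      (trans (cong₂ _+_ (count-splits s c (suc a) j (drop-∷-⊆ s⊆c)) (count-splits s c a j (drop-∷-⊆ s⊆c)))
        (trans (sym (ℕₚ.*-distribʳ-+ (∣ c ─ s ∣ C j) (∣ s ∣ C suc a) (∣ s ∣ C a)))
               (cong (_* (∣ c ─ s ∣ C j)) (C-pascal ∣ s ∣ a))))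

  ⊆ᵇ-∪ : ∀ {n} {s c : Subset n} t′ → s ⊆ c → ⊆ᵇ (s ∪ t′) c ≡ ⊆ᵇ t′ c
  ⊆ᵇ-∪ {s = s} {c} t′ s⊆c with t′ ⊆? c
  ... | yes t′⊆c = ⊆ᵇ-true (∪-⊆ s⊆c t′⊆c)
  ... | no t′⊈c  = ⊆ᵇ-false (λ s∪t′⊆c → t′⊈c (⊆-trans (q⊆p∪q s t′) s∪t′⊆c))

  admissible≡splits : ∀ {n} l j (s c t : Subset n) → j ≤ l →
    admissible l j s c t ≡ splits s c (l ∸ j) j t
  admissible≡splits l j s c t j≤l with t ⊆? c
  ... | no _     = refl
  ... | yes t⊆c with ∣ t ∩ (c ─ s) ∣ ℕ.≡ᵇ j in ∣t∩[c─s]∣≡ᵇj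
  ...   | false = trans (Boolₚ.∧-zeroʳ _) (sym (Boolₚ.∧-zeroʳ _))
  ...   | true  = cong (_∧ true) (begin
    ∣ t ∣ ℕ.≡ᵇ l                              ≡⟨ cong₂ ℕ._≡ᵇ_ ∣t∣≡j+∣t∩s∣ (sym (ℕₚ.m+[n∸m]≡n j≤l)) ⟩
    (j + ∣ t ∩ s ∣) ℕ.≡ᵇ (j + (l ∸ j))        ≡⟨ [a+x≡ᵇa+y]≡[x≡ᵇy] j ∣ t ∩ s ∣ (l ∸ j) ⟩
    ∣ t ∩ s ∣ ℕ.≡ᵇ (l ∸ j) ∎)
    where
    open ≡-Reasoning
    ∣t∣≡j+∣t∩s∣ : ∣ t ∣ ≡ j + ∣ t ∩ s ∣
    ∣t∣≡j+∣t∩s∣ = trans (∣t∣≡∣t∩s∣+∣t∩[c─s]∣ t c s t⊆c)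
                        (trans (cong (∣ t ∩ s ∣ +_) (≡ᵇ⇒≡ ∣t∩[c─s]∣≡ᵇj)) (ℕₚ.+-comm ∣ t ∩ s ∣ j))

  count-admissible : ∀ {n} l j (s c : Subset n) → j ≤ l → s ⊆ c →
    count (admissible l j s c) (allSubsets n) ≡ (∣ s ∣ C (l ∸ j)) * (∣ c ─ s ∣ C j)
  count-admissible l j s c j≤l s⊆c =
    trans (count-cong (allSubsets _) (λ t → admissible≡splits l j s c t j≤l))
          (count-splits s c (l ∸ j) j s⊆c)

  admissible-s′∪t′ : ∀ {n} {l j} {s′ s t′ : Subset n} c → s′ ⊆ s → Empty (t′ ∩ s) →
    ∣ t′ ∣ ≡ j → ∣ s′ ∪ t′ ∣ ≡ l → s ⊆ c → admissible l j s c (s′ ∪ t′) ≡ ⊆ᵇ t′ c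
  admissible-s′∪t′ {s′ = s′} {s} {t′} c s′⊆s empty ∣t′∣≡j ∣s′∪t′∣≡l s⊆c with t′ ⊆? c
  ... | no t′⊈c
    rewrite ⊆ᵇ-false {p = s′ ∪ t′} {c} (λ s′∪t′⊆c → t′⊈c (⊆-trans (q⊆p∪q s′ t′) s′∪t′⊆c)) = refl
  ... | yes t′⊆c
    rewrite ⊆ᵇ-true (∪-⊆ (⊆-trans s′⊆s s⊆c) t′⊆c) | ≡⇒≡ᵇ ∣s′∪t′∣≡l
          | [s′∪t′]∩[c─s]≡t′ s′ s t′ c s′⊆s empty t′⊆c | ≡⇒≡ᵇ ∣t′∣≡j = refl

admissible-weight : ∀ {n j l k u} {s s′ t′ c : Subset n} → j ℕ.≤ l → ∣ s ∣ ≡ k → s′ ⊆ s →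
  ∣ t′ ∣ ≡ j → Empty (t′ ∩ s) → ∣ s′ ∪ t′ ∣ ≡ l → s ⊆ c → ∣ c ∣ ≡ k ℕ.+ u →
  [ admissible l j s c (s′ ∪ t′) ] /' ℕ→ℚ (count (admissible l j s c) (allSubsets n))
    ≡ [ ⊆ᵇ t′ c ] ℚ.* inv (ℕ→ℚ (k C (l ∸ j)) ℚ.* ℕ→ℚ (u C j))
admissible-weight {n} {j} {l} {k} {u} {s} {s′} {t′} {c} j≤l ∣s∣≡k s′⊆s ∣t′∣≡j empty ∣s′∪t′∣≡l s⊆c ∣c∣≡k+u =
  trans (/'≡*inv [ admissible l j s c (s′ ∪ t′) ] (ℕ→ℚ (count (admissible l j s c) (allSubsets n))))
        (cong₂ (λ a N → [ a ] ℚ.* inv N)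
               (admissible-s′∪t′ c s′⊆s empty ∣t′∣≡j ∣s′∪t′∣≡l s⊆c) #admissible≡Ckl*Cuj)
  where
  open ≡-Reasoning
  ∣c─s∣≡u : ∣ c ─ s ∣ ≡ u
  ∣c─s∣≡u = p⊆q∧∣q∣≡k+e⇒∣q─p∣≡e s⊆c ∣s∣≡k ∣c∣≡k+u
  #admissible≡Ckl*Cuj : ℕ→ℚ (count (admissible l j s c) (allSubsets n)) ≡ ℕ→ℚ (k C (l ∸ j)) ℚ.* ℕ→ℚ (u C j)
  #admissible≡Ckl*Cuj = begin
    ℕ→ℚ (count (admissible l j s c) (allSubsets n))
      ≡⟨ cong ℕ→ℚ (count-admissible l j s c j≤l s⊆c) ⟩
    ℕ→ℚ ((∣ s ∣ C (l ∸ j)) ℕ.* (∣ c ─ s ∣ C j))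
      ≡⟨ cong₂ (λ a e → ℕ→ℚ ((a C (l ∸ j)) ℕ.* (e C j))) ∣s∣≡k ∣c─s∣≡u ⟩
    ℕ→ℚ ((k C (l ∸ j)) ℕ.* (u C j))
      ≡⟨ ℕ→ℚ-* (k C (l ∸ j)) (u C j) ⟩
    ℕ→ℚ (k C (l ∸ j)) ℚ.* ℕ→ℚ (u C j) ∎

-- The measures Π_i and the up-walk

module Measure {n : ℕ} (d : ℕ) (Πd : Subset n → ℚ)
               (Πd-nonneg : ∀ f → 0ℚ ℚ.≤ Πd f) (Πd-size : ∀ f → Πd f ≢ 0ℚ → ∣ f ∣ ≡ d) where
  open import Data.Nat using (_+_; _≤_)
  open import Data.Rational using (_*_)
  open ≡-Reasoning

  mass : Subset n → ℚ
  mass b = Σsub (λ f → [ ⊆ᵇ b f ] * Πd f)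

  mass-nonneg : ∀ b → 0ℚ ℚ.≤ mass b
  mass-nonneg b = ∑-nonneg (allSubsets n) (λ f → [b]*q-nonneg (⊆ᵇ b f) (Πd-nonneg f))

  mass-antitone : ∀ {r t} → r ⊆ t → mass t ℚ.≤ mass r
  mass-antitone {r} {t} r⊆t = ∑-mono-≤ (allSubsets n) termwise
    where
    termwise : ∀ f → [ ⊆ᵇ t f ] * Πd f ℚ.≤ [ ⊆ᵇ r f ] * Πd f
    termwise f with t ⊆? f | r ⊆? f
    ... | yes _   | yes _   = ℚₚ.≤-refl
    ... | yes t⊆f | no r⊈f  = ⊥-elim (r⊈f (⊆-trans r⊆t t⊆f))
    ... | no _    | r?      = subst (ℚ._≤ [ does r? ] * Πd f) (sym (ℚₚ.*-zeroˡ (Πd f)))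
                                    ([b]*q-nonneg (does r?) (Πd-nonneg f))

  Π-unfold : ∀ {i} b → ∣ b ∣ ≡ i → Π d Πd i b ≡ mass b /' ℕ→ℚ (d C i)
  Π-unfold {i} b ∣b∣≡i with ∣ b ∣ ℕ.≟ i
  ... | yes _     = refl
  ... | no ∣b∣≢i  = contradiction ∣b∣≡i ∣b∣≢i

  Π-≡ : ∀ {i} b → ∣ b ∣ ≡ i → Π d Πd i b ≡ mass b * inv (ℕ→ℚ (d C i))
  Π-≡ {i} b ∣b∣≡i = trans (Π-unfold b ∣b∣≡i) (/'≡*inv (mass b) (ℕ→ℚ (d C i)))

  Π-≢ : ∀ {i} b → ∣ b ∣ ≢ i → Π d Πd i b ≡ 0ℚ
  Π-≢ {i} b ∣b∣≢i with ∣ b ∣ ℕ.≟ i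
  ... | yes ∣b∣≡i = contradiction ∣b∣≡i ∣b∣≢i
  ... | no _      = refl

  Π≢0⇒∣∣≡ : ∀ {i} b → Π d Πd i b ≢ 0ℚ → ∣ b ∣ ≡ i
  Π≢0⇒∣∣≡ {i} b Π≢0 with ∣ b ∣ ℕ.≟ i
  ... | yes ∣b∣≡i = ∣b∣≡i
  ... | no _      = contradiction refl Π≢0

  up-≡ : ∀ {i r} t → ∣ r ∣ ≡ i →
    up d Πd r t ≡ [ ⊆ᵇ r t ] * (Π d Πd (suc i) t * inv (ℕ→ℚ (suc i) * Π d Πd i r))
  -- The with-abstraction evaluates the Π (suc ∣ r ∣) t of the right-hand side, but not the
  -- one that appears when up reduces; Π-unfold relates the two.
  up-≡ {r = r} t refl with ∣ t ∣ ℕ.≟ suc ∣ r ∣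
  ... | yes ∣t∣≡1+∣r∣ = cong ([ ⊆ᵇ r t ] *_)
    (trans (/'≡*inv (Π d Πd (suc ∣ r ∣) t) D) (cong (_* inv D) (Π-unfold t ∣t∣≡1+∣r∣)))
    where
    D : ℚ
    D = ℕ→ℚ (suc ∣ r ∣) * Π d Πd ∣ r ∣ r
  ... | no _ = sym (trans (cong ([ ⊆ᵇ r t ] *_) (ℚₚ.*-zeroˡ (inv D))) (ℚₚ.*-zeroʳ [ ⊆ᵇ r t ]))
    where
    D : ℚ
    D = ℕ→ℚ (suc ∣ r ∣) * Π d Πd ∣ r ∣ r

  Π-zero-upward : ∀ {i r t} → r ⊆ t → ∣ r ∣ ≡ i → Π d Πd i r ≡ 0ℚ → Π d Πd (suc i) t ≡ 0ℚ
  Π-zero-upward {i} {r} {t} r⊆t ∣r∣≡i Πr≡0 = cases (∣ t ∣ ℕ.≟ suc i) (i ℕ.≤? d)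
    where
    cases : Dec (∣ t ∣ ≡ suc i) → Dec (i ≤ d) → Π d Πd (suc i) t ≡ 0ℚ
    cases (no ∣t∣≢1+i) _ = Π-≢ t ∣t∣≢1+i
    cases (yes ∣t∣≡1+i) (no i≰d) = begin
      Π d Πd (suc i) t                    ≡⟨ Π-≡ t ∣t∣≡1+i ⟩
      mass t * inv (ℕ→ℚ (d C suc i))     ≡⟨ cong (λ c → mass t * inv (ℕ→ℚ c)) d<1+i⇒dC[1+i]≡0 ⟩
      mass t * 0ℚ                         ≡⟨ ℚₚ.*-zeroʳ (mass t) ⟩
      0ℚ ∎
      where
      d<1+i⇒dC[1+i]≡0 : d C suc i ≡ 0
      d<1+i⇒dC[1+i]≡0 = k>n⇒nCk≡0 (ℕₚ.m<n⇒m<1+n (ℕₚ.≰⇒> i≰d))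
    cases (yes ∣t∣≡1+i) (yes i≤d) = begin
      Π d Πd (suc i) t                    ≡⟨ Π-≡ t ∣t∣≡1+i ⟩
      mass t * inv (ℕ→ℚ (d C suc i))     ≡⟨ cong (_* inv (ℕ→ℚ (d C suc i))) mass-t≡0 ⟩
      0ℚ * inv (ℕ→ℚ (d C suc i))         ≡⟨ ℚₚ.*-zeroˡ (inv (ℕ→ℚ (d C suc i))) ⟩
      0ℚ ∎
      where
      c≢0 : ℕ→ℚ (d C i) ≢ 0ℚ
      c≢0 = ℕ→ℚ-≢0 (d C i) {{C-nonZero i≤d}}
      mass-r≡0 : mass r ≡ 0ℚ
      mass-r≡0 = begin
        mass r                                       ≡⟨ *-inv-cancelʳ (mass r) (ℕ→ℚ (d C i)) c≢0 ⟨
        mass r * inv (ℕ→ℚ (d C i)) * ℕ→ℚ (d C i)    ≡⟨ cong (_* ℕ→ℚ (d C i)) (trans (sym (Π-≡ r ∣r∣≡i)) Πr≡0) ⟩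
        0ℚ * ℕ→ℚ (d C i)                             ≡⟨ ℚₚ.*-zeroˡ (ℕ→ℚ (d C i)) ⟩
        0ℚ ∎
      mass-t≡0 : mass t ≡ 0ℚ
      mass-t≡0 = ℚₚ.≤-antisym (subst (mass t ℚ.≤_) mass-r≡0 (mass-antitone r⊆t)) (mass-nonneg t)

  between-Π-zero : ∀ {k s} → ∣ s ∣ ≡ k → ∀ u r t → s ⊆ r → Π d Πd (k + u) r ≡ 0ℚ → ∀ x →
    [ ⊆ᵇ r t ∧ (∣ r ─ s ∣ ℕ.≡ᵇ u) ] * (Π d Πd (suc (k + u)) t * x) ≡ 0ℚ
  between-Π-zero {k} {s} ∣s∣≡k u r t s⊆r Πr≡0 x with r ⊆? t | ∣ r ─ s ∣ ℕ.≡ᵇ u in ∣r─s∣≡ᵇu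
  ... | yes r⊆t | true = begin
    1ℚ * (Π d Πd (suc (k + u)) t * x)     ≡⟨ ℚₚ.*-identityˡ (Π d Πd (suc (k + u)) t * x) ⟩
    Π d Πd (suc (k + u)) t * x            ≡⟨ cong (_* x) (Π-zero-upward r⊆t ∣r∣≡k+u Πr≡0) ⟩
    0ℚ * x                                ≡⟨ ℚₚ.*-zeroˡ x ⟩
    0ℚ ∎
    where
    ∣r∣≡k+u : ∣ r ∣ ≡ k + u
    ∣r∣≡k+u = trans (∣q∣≡∣p∣+∣q─p∣ s⊆r) (cong₂ _+_ ∣s∣≡k (≡ᵇ⇒≡ ∣r─s∣≡ᵇu))
  ... | yes _ | false = ℚₚ.*-zeroˡ (Π d Πd (suc (k + u)) t * x)
  ... | no _  | _     = ℚₚ.*-zeroˡ (Π d Πd (suc (k + u)) t * x)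

  pUp-step-term : ∀ {k s} → ∣ s ∣ ≡ k → ∀ u A r t →
    [ ⊆ᵇ s r ] * (Π d Πd (k + u) r * A) * up d Πd r t
      ≡ [ between s t u r ] * (Π d Πd (suc (k + u)) t * (inv (ℕ→ℚ (suc (k + u))) * A))
  pUp-step-term {k} {s} ∣s∣≡k u A r t with s ⊆? r
  ... | no _ = trans (cong (_* up d Πd r t) (ℚₚ.*-zeroˡ (Π d Πd (k + u) r * A)))
                     (trans (ℚₚ.*-zeroˡ (up d Πd r t)) (sym (ℚₚ.*-zeroˡ Z)))
    where
    Z : ℚ
    Z = Π d Πd (suc (k + u)) t * (inv (ℕ→ℚ (suc (k + u))) * A)
  ... | yes s⊆r =
    trans (cong (_* up d Πd r t) (ℚₚ.*-identityˡ (Π d Πd (k + u) r * A))) (cases (Π d Πd (k + u) r ≟ 0ℚ))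
    where
    m : ℕ
    m = k + u
    N Πr P′ : ℚ
    N = ℕ→ℚ (suc m)
    Πr = Π d Πd m r
    P′ = Π d Πd (suc m) t
    cases : Dec (Πr ≡ 0ℚ) →
      Πr * A * up d Πd r t ≡ [ ⊆ᵇ r t ∧ (∣ r ─ s ∣ ℕ.≡ᵇ u) ] * (P′ * (inv N * A))
    cases (yes Πr≡0) = begin
      Πr * A * up d Πd r t     ≡⟨ cong (λ x → x * A * up d Πd r t) Πr≡0 ⟩
      0ℚ * A * up d Πd r t     ≡⟨ cong (_* up d Πd r t) (ℚₚ.*-zeroˡ A) ⟩
      0ℚ * up d Πd r t         ≡⟨ ℚₚ.*-zeroˡ (up d Πd r t) ⟩
      0ℚ                       ≡⟨ between-Π-zero ∣s∣≡k u r t s⊆r Πr≡0 (inv N * A) ⟨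
      [ ⊆ᵇ r t ∧ (∣ r ─ s ∣ ℕ.≡ᵇ u) ] * (P′ * (inv N * A)) ∎
    cases (no Πr≢0) = begin
      Πr * A * up d Πd r t
        ≡⟨ cong (Πr * A *_) (up-≡ t ∣r∣≡m) ⟩
      Πr * A * ([ ⊆ᵇ r t ] * (P′ * inv (N * Πr)))
        ≡⟨ cong (λ x → Πr * A * ([ ⊆ᵇ r t ] * (P′ * x))) (inv-* N Πr) ⟩
      Πr * A * ([ ⊆ᵇ r t ] * (P′ * (inv N * inv Πr)))
        ≡⟨ shuffle Πr A [ ⊆ᵇ r t ] P′ (inv N) (inv Πr) ⟩
      [ ⊆ᵇ r t ] * (P′ * (inv N * A)) * (Πr * inv Πr)
        ≡⟨ cong ([ ⊆ᵇ r t ] * (P′ * (inv N * A)) *_) (*-inv Πr Πr≢0) ⟩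
      [ ⊆ᵇ r t ] * (P′ * (inv N * A)) * 1ℚ
        ≡⟨ ℚₚ.*-identityʳ _ ⟩
      [ ⊆ᵇ r t ] * (P′ * (inv N * A))
        ≡⟨ cong (λ b → [ b ] * (P′ * (inv N * A))) (sym (Boolₚ.∧-identityʳ (⊆ᵇ r t))) ⟩
      [ ⊆ᵇ r t ∧ true ] * (P′ * (inv N * A))
        ≡⟨ cong (λ b → [ ⊆ᵇ r t ∧ b ] * (P′ * (inv N * A))) (sym (≡⇒≡ᵇ ∣r─s∣≡u)) ⟩
      [ ⊆ᵇ r t ∧ (∣ r ─ s ∣ ℕ.≡ᵇ u) ] * (P′ * (inv N * A)) ∎
      where
      ∣r∣≡m : ∣ r ∣ ≡ m
      ∣r∣≡m = Π≢0⇒∣∣≡ r Πr≢0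
      ∣r─s∣≡u : ∣ r ─ s ∣ ≡ u
      ∣r─s∣≡u = p⊆q∧∣q∣≡k+e⇒∣q─p∣≡e s⊆r ∣s∣≡k ∣r∣≡m
      shuffle : ∀ p a b p′ n q → p * a * (b * (p′ * (n * q))) ≡ b * (p′ * (n * a)) * (p * q)
      shuffle = solve 6 (λ p a b p′ n q → p :* a :* (b :* (p′ :* (n :* q))) := b :* (p′ :* (n :* a)) :* (p :* q)) refl

  pUp-step-sum : ∀ {k s} → ∣ s ∣ ≡ k → ∀ u Q t →
    ℕ→ℚ (count (between s t u) (allSubsets n))
      * (Π d Πd (suc (k + u)) t * (inv (ℕ→ℚ (suc (k + u))) * inv (ℕ→ℚ ((k + u) C u) * Q)))
      ≡ [ ⊆ᵇ s t ] * (Π d Πd (k + suc u) t * inv (ℕ→ℚ ((k + suc u) C suc u) * Q))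
  pUp-step-sum {k} {s} ∣s∣≡k u Q t = cases (s ⊆? t)
    where
    X Z R : ℚ
    X = inv (ℕ→ℚ (suc (k + u))) * inv (ℕ→ℚ ((k + u) C u) * Q)
    Z = Π d Πd (suc (k + u)) t * X
    R = Π d Πd (k + suc u) t * inv (ℕ→ℚ ((k + suc u) C suc u) * Q)
    cases : Dec (s ⊆ t) → ℕ→ℚ (count (between s t u) (allSubsets n)) * Z ≡ [ ⊆ᵇ s t ] * R
    cases (no s⊈t) = begin
      ℕ→ℚ (count (between s t u) (allSubsets n)) * Z   ≡⟨ cong (λ c → ℕ→ℚ c * Z) (count-between-⊈ u s⊈t) ⟩
      0ℚ * Z                                           ≡⟨ ℚₚ.*-zeroˡ Z ⟩
      0ℚ                                               ≡⟨ ℚₚ.*-zeroˡ R ⟨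
      0ℚ * R                                           ≡⟨ cong (λ b → [ b ] * R) (⊆ᵇ-false s⊈t) ⟨
      [ ⊆ᵇ s t ] * R ∎
    cases (yes s⊆t) = begin
      ℕ→ℚ (count (between s t u) (allSubsets n)) * Z   ≡⟨ cong (λ c → ℕ→ℚ c * Z) (count-between s t u s⊆t) ⟩
      ℕ→ℚ (∣ t ─ s ∣ C u) * Z                          ≡⟨ sizes (∣ t ∣ ℕ.≟ suc (k + u)) ⟩
      1ℚ * R                                           ≡⟨ cong (λ b → [ b ] * R) (⊆ᵇ-true s⊆t) ⟨
      [ ⊆ᵇ s t ] * R ∎
      where
      P′ P″ C′ : ℚ
      P′  = Π d Πd (suc (k + u)) t
      P″  = Π d Πd (k + suc u) t
      C′  = ℕ→ℚ ((k + suc u) C suc u)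
      swap : ∀ s p x → s * (p * x) ≡ p * (s * x)
      swap = solve 3 (λ s p x → s :* (p :* x) := p :* (s :* x)) refl
      sizes : Dec (∣ t ∣ ≡ suc (k + u)) → ℕ→ℚ (∣ t ─ s ∣ C u) * Z ≡ 1ℚ * (P″ * inv (C′ * Q))
      sizes (yes ∣t∣≡1+k+u) = begin
        ℕ→ℚ (∣ t ─ s ∣ C u) * Z                 ≡⟨ cong (λ c → ℕ→ℚ (c C u) * Z) ∣t─s∣≡1+u ⟩
        ℕ→ℚ (suc u C u) * Z                     ≡⟨ cong (λ c → ℕ→ℚ c * Z) ([1+u]Cu≡1+u u) ⟩
        ℕ→ℚ (suc u) * (P′ * X)                  ≡⟨ swap (ℕ→ℚ (suc u)) P′ X ⟩
        P′ * (ℕ→ℚ (suc u) * X)                  ≡⟨ cong (P′ *_) (C-absorption-inv k u Q) ⟩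
        P′ * inv (C′ * Q)                       ≡⟨ cong (λ i → Π d Πd i t * inv (C′ * Q)) (ℕₚ.+-suc k u) ⟨
        P″ * inv (C′ * Q)                       ≡⟨ ℚₚ.*-identityˡ (P″ * inv (C′ * Q)) ⟨
        1ℚ * (P″ * inv (C′ * Q)) ∎
        where
        ∣t─s∣≡1+u : ∣ t ─ s ∣ ≡ suc u
        ∣t─s∣≡1+u = p⊆q∧∣q∣≡k+e⇒∣q─p∣≡e s⊆t ∣s∣≡k (trans ∣t∣≡1+k+u (sym (ℕₚ.+-suc k u)))
      sizes (no ∣t∣≢1+k+u) = begin
        ℕ→ℚ (∣ t ─ s ∣ C u) * (P′ * X)
          ≡⟨ cong (λ x → ℕ→ℚ (∣ t ─ s ∣ C u) * (x * X)) (Π-≢ t ∣t∣≢1+k+u) ⟩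
        ℕ→ℚ (∣ t ─ s ∣ C u) * (0ℚ * X)
          ≡⟨ cong (ℕ→ℚ (∣ t ─ s ∣ C u) *_) (ℚₚ.*-zeroˡ X) ⟩
        ℕ→ℚ (∣ t ─ s ∣ C u) * 0ℚ
          ≡⟨ ℚₚ.*-zeroʳ (ℕ→ℚ (∣ t ─ s ∣ C u)) ⟩
        0ℚ
          ≡⟨ ℚₚ.*-zeroˡ (inv (C′ * Q)) ⟨
        0ℚ * inv (C′ * Q)
          ≡⟨ cong (_* inv (C′ * Q)) (Π-≢ t (λ eq → ∣t∣≢1+k+u (trans eq (ℕₚ.+-suc k u)))) ⟨
        P″ * inv (C′ * Q)
          ≡⟨ ℚₚ.*-identityˡ (P″ * inv (C′ * Q)) ⟨
        1ℚ * (P″ * inv (C′ * Q)) ∎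

  pUp-zero : ∀ {k s} → ∣ s ∣ ≡ k → Π d Πd k s ≢ 0ℚ → ∀ t →
    pUp d Πd 0 s t ≡ [ ⊆ᵇ s t ] * (Π d Πd (k + 0) t * inv (ℕ→ℚ ((k + 0) C 0) * Π d Πd k s))
  pUp-zero {k} {s} ∣s∣≡k Πs≢0 t = cases (s ⊆? t) (t ⊆? s)
    where
    Q R : ℚ
    Q = Π d Πd k s
    R = Π d Πd (k + 0) t * inv (1ℚ * Q)
    cases : Dec (s ⊆ t) → Dec (t ⊆ s) → [ ⊆ᵇ s t ∧ ⊆ᵇ t s ] ≡ [ ⊆ᵇ s t ] * R
    cases (no s⊈t) _ = begin
      [ ⊆ᵇ s t ∧ ⊆ᵇ t s ]   ≡⟨ cong (λ b → [ b ∧ ⊆ᵇ t s ]) (⊆ᵇ-false s⊈t) ⟩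
      0ℚ                    ≡⟨ ℚₚ.*-zeroˡ R ⟨
      0ℚ * R                ≡⟨ cong (λ b → [ b ] * R) (⊆ᵇ-false s⊈t) ⟨
      [ ⊆ᵇ s t ] * R ∎
    cases (yes s⊆t) (no t⊈s) = begin
      [ ⊆ᵇ s t ∧ ⊆ᵇ t s ]        ≡⟨ cong₂ (λ a b → [ a ∧ b ]) (⊆ᵇ-true s⊆t) (⊆ᵇ-false t⊈s) ⟩
      0ℚ                         ≡⟨ ℚₚ.*-zeroˡ (inv (1ℚ * Q)) ⟨
      0ℚ * inv (1ℚ * Q)          ≡⟨ cong (_* inv (1ℚ * Q)) (Π-≢ t ∣t∣≢k+0) ⟨
      R                          ≡⟨ ℚₚ.*-identityˡ R ⟨
      1ℚ * R                     ≡⟨ cong (λ b → [ b ] * R) (⊆ᵇ-true s⊆t) ⟨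
      [ ⊆ᵇ s t ] * R ∎
      where
      ∣t∣≢k+0 : ∣ t ∣ ≢ k + 0
      ∣t∣≢k+0 ∣t∣≡k+0 = t⊈s (∣p─q∣≡0⇒p⊆q t s (p⊆q∧∣q∣≡k+e⇒∣q─p∣≡e s⊆t ∣s∣≡k ∣t∣≡k+0))
    cases (yes s⊆t) (yes t⊆s) = begin
      [ ⊆ᵇ s t ∧ ⊆ᵇ t s ]        ≡⟨ cong₂ (λ a b → [ a ∧ b ]) (⊆ᵇ-true s⊆t) (⊆ᵇ-true t⊆s) ⟩
      1ℚ                         ≡⟨ *-inv Q Πs≢0 ⟨
      Q * inv Q                  ≡⟨ cong (λ x → Q * inv x) (ℚₚ.*-identityˡ Q) ⟨
      Q * inv (1ℚ * Q)           ≡⟨ cong₂ (λ i b → Π d Πd i b * inv (1ℚ * Q))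
                                          (ℕₚ.+-identityʳ k) (⊆-antisym t⊆s s⊆t) ⟨
      R                          ≡⟨ ℚₚ.*-identityˡ R ⟨
      1ℚ * R                     ≡⟨ cong (λ b → [ b ] * R) (⊆ᵇ-true s⊆t) ⟨
      [ ⊆ᵇ s t ] * R ∎

  pUp-closed : ∀ {k s} → ∣ s ∣ ≡ k → Π d Πd k s ≢ 0ℚ → ∀ u t →
    pUp d Πd u s t ≡ [ ⊆ᵇ s t ] * (Π d Πd (k + u) t * inv (ℕ→ℚ ((k + u) C u) * Π d Πd k s))
  pUp-closed {s = s} ∣s∣≡k Πs≢0 zero t = pUp-zero {s = s} ∣s∣≡k Πs≢0 t
  pUp-closed {k} {s} ∣s∣≡k Πs≢0 (suc u) t = begin
    Σsub (λ r → pUp d Πd u s r * up d Πd r t)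
      ≡⟨ ∑-cong (allSubsets n) (λ r →
           trans (cong (_* up d Πd r t) (pUp-closed {s = s} ∣s∣≡k Πs≢0 u r)) (pUp-step-term {s = s} ∣s∣≡k u A r t)) ⟩
    Σsub (λ r → [ between s t u r ] * Z)
      ≡⟨ ∑-*ʳ (allSubsets n) Z (λ r → [ between s t u r ]) ⟩
    Σsub (λ r → [ between s t u r ]) * Z
      ≡⟨ cong (_* Z) (∑-indicator (between s t u) (allSubsets n)) ⟩
    ℕ→ℚ (count (between s t u) (allSubsets n)) * Z
      ≡⟨ pUp-step-sum {s = s} ∣s∣≡k u (Π d Πd k s) t ⟩
    [ ⊆ᵇ s t ] * (Π d Πd (k + suc u) t * inv (ℕ→ℚ ((k + suc u) C suc u) * Π d Πd k s)) ∎
    where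
    A Z : ℚ
    A = inv (ℕ→ℚ ((k + u) C u) * Π d Πd k s)
    Z = Π d Πd (suc (k + u)) t * (inv (ℕ→ℚ (suc (k + u))) * A)

  count-between-top : ∀ b f e → Πd f ≢ 0ℚ →
    ℕ→ℚ (count (between b f e) (allSubsets n)) ≡ ℕ→ℚ ((d ∸ ∣ b ∣) C e) * [ ⊆ᵇ b f ]
  count-between-top b f e Πf≢0 with b ⊆? f
  ... | no b⊈f  = trans (cong ℕ→ℚ (count-between-⊈ e b⊈f)) (sym (ℚₚ.*-zeroʳ (ℕ→ℚ ((d ∸ ∣ b ∣) C e))))
  ... | yes b⊆f = begin
    ℕ→ℚ (count (between b f e) (allSubsets n))  ≡⟨ cong ℕ→ℚ (count-between b f e b⊆f) ⟩
    ℕ→ℚ (∣ f ─ b ∣ C e)                          ≡⟨ cong (λ x → ℕ→ℚ (x C e)) ∣f─b∣≡d∸∣b∣ ⟩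
    ℕ→ℚ ((d ∸ ∣ b ∣) C e)                        ≡⟨ ℚₚ.*-identityʳ (ℕ→ℚ ((d ∸ ∣ b ∣) C e)) ⟨
    ℕ→ℚ ((d ∸ ∣ b ∣) C e) * 1ℚ ∎
    where
    ∣f─b∣≡d∸∣b∣ : ∣ f ─ b ∣ ≡ d ∸ ∣ b ∣
    ∣f─b∣≡d∸∣b∣ = sym (trans (cong (_∸ ∣ b ∣) (trans (sym (Πd-size f Πf≢0)) (∣q∣≡∣p∣+∣q─p∣ b⊆f)))
                            (ℕₚ.m+n∸m≡n ∣ b ∣ ∣ f ─ b ∣))

  -- Double counting: a top face f ⊇ b contains C(d ∸ |b|, e) sets c ⊇ b of size |b| + e.
  ∑-mass-supersets : ∀ b e m → m ≡ ∣ b ∣ + e →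
    Σsub (λ c → [ ⊆ᵇ b c ∧ (∣ c ∣ ℕ.≡ᵇ m) ] * mass c) ≡ ℕ→ℚ ((d ∸ ∣ b ∣) C e) * mass b
  ∑-mass-supersets b e m m≡∣b∣+e = begin
    ∑ all (λ c → [ A c ] * mass c)
      ≡⟨ ∑-cong all (λ c → ∑-*ˡ all [ A c ] (λ f → [ ⊆ᵇ c f ] * Πd f)) ⟨
    ∑ all (λ c → ∑ all (λ f → [ A c ] * ([ ⊆ᵇ c f ] * Πd f)))
      ≡⟨ ∑-swap all all (λ c f → [ A c ] * ([ ⊆ᵇ c f ] * Πd f)) ⟩
    ∑ all (λ f → ∑ all (λ c → [ A c ] * ([ ⊆ᵇ c f ] * Πd f)))
      ≡⟨ ∑-cong all (λ f → inner f) ⟩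
    ∑ all (λ f → Cd * ([ ⊆ᵇ b f ] * Πd f))
      ≡⟨ ∑-*ˡ all Cd (λ f → [ ⊆ᵇ b f ] * Πd f) ⟩
    Cd * mass b ∎
    where
    all : List (Subset n)
    all = allSubsets n
    Cd : ℚ
    Cd = ℕ→ℚ ((d ∸ ∣ b ∣) C e)
    A : Subset n → Bool
    A c = ⊆ᵇ b c ∧ (∣ c ∣ ℕ.≡ᵇ m)
    inner : ∀ f → ∑ all (λ c → [ A c ] * ([ ⊆ᵇ c f ] * Πd f)) ≡ Cd * ([ ⊆ᵇ b f ] * Πd f)
    inner f = begin
      ∑ all (λ c → [ A c ] * ([ ⊆ᵇ c f ] * Πd f))
        ≡⟨ ∑-cong all (λ c → trans ([a]*[[b]*q]≡[a∧b]*q (A c) (⊆ᵇ c f) (Πd f))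
                                   (cong (λ x → [ x ] * Πd f) (sized-superset∧⊆≡between b c f e m m≡∣b∣+e))) ⟩
      ∑ all (λ c → [ between b f e c ] * Πd f)
        ≡⟨ ∑-*ʳ all (Πd f) (λ c → [ between b f e c ]) ⟩
      ∑ all (λ c → [ between b f e c ]) * Πd f
        ≡⟨ cong (_* Πd f) (∑-indicator (between b f e) all) ⟩
      ℕ→ℚ (count (between b f e) all) * Πd f
        ≡⟨ weight (Πd f ≟ 0ℚ) ⟩
      Cd * [ ⊆ᵇ b f ] * Πd f
        ≡⟨ ℚₚ.*-assoc Cd [ ⊆ᵇ b f ] (Πd f) ⟩
      Cd * ([ ⊆ᵇ b f ] * Πd f) ∎
      where
      weight : Dec (Πd f ≡ 0ℚ) → ℕ→ℚ (count (between b f e) all) * Πd f ≡ Cd * [ ⊆ᵇ b f ] * Πd f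
      weight (yes Πf≡0) = begin
        ℕ→ℚ (count (between b f e) all) * Πd f   ≡⟨ cong (ℕ→ℚ (count (between b f e) all) *_) Πf≡0 ⟩
        ℕ→ℚ (count (between b f e) all) * 0ℚ     ≡⟨ ℚₚ.*-zeroʳ (ℕ→ℚ (count (between b f e) all)) ⟩
        0ℚ                                       ≡⟨ ℚₚ.*-zeroʳ (Cd * [ ⊆ᵇ b f ]) ⟨
        Cd * [ ⊆ᵇ b f ] * 0ℚ                     ≡⟨ cong (Cd * [ ⊆ᵇ b f ] *_) Πf≡0 ⟨
        Cd * [ ⊆ᵇ b f ] * Πd f ∎
      weight (no Πf≢0)  = cong (_* Πd f) (count-between-top b f e Πf≢0)

  Swalk-summand : ∀ {j l k u} {s s′ t′ : Subset n} → j ≤ l →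
    ∣ s ∣ ≡ k → Π d Πd k s ≢ 0ℚ → s′ ⊆ s → ∣ t′ ∣ ≡ j → Empty (t′ ∩ s) → ∣ s′ ∪ t′ ∣ ≡ l → ∀ c →
    pUp d Πd u s c * ([ admissible l j s c (s′ ∪ t′) ] /' ℕ→ℚ (count (admissible l j s c) (allSubsets n)))
      ≡ [ ⊆ᵇ (s ∪ t′) c ∧ (∣ c ∣ ℕ.≡ᵇ (k + u)) ] * mass c
          * (inv (ℕ→ℚ (d C (k + u))) * (inv (ℕ→ℚ ((k + u) C u) * Π d Πd k s)
                                       * inv (ℕ→ℚ (k C (l ∸ j)) * ℕ→ℚ (u C j))))
  Swalk-summand {j} {l} {k} {u} {s} {s′} {t′} j≤l ∣s∣≡k Πs≢0 s′⊆s ∣t′∣≡j empty ∣s′∪t′∣≡l c =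
    trans (cong (_* X) (pUp-closed {s = s} ∣s∣≡k Πs≢0 u c)) (cases (s ⊆? c) (∣ c ∣ ℕ.≟ m))
    where
    t b : Subset n
    t = s′ ∪ t′
    b = s ∪ t′
    m : ℕ
    m = k + u
    all : List (Subset n)
    all = allSubsets n
    Q Ckl Cuj Cmu Dm K : ℚ
    Q = Π d Πd k s
    Ckl = ℕ→ℚ (k C (l ∸ j))
    Cuj = ℕ→ℚ (u C j)
    Cmu = ℕ→ℚ (m C u)
    Dm  = ℕ→ℚ (d C m)
    K = inv Dm * (inv (Cmu * Q) * inv (Ckl * Cuj))
    B : Subset n → Bool
    B c′ = ⊆ᵇ b c′ ∧ (∣ c′ ∣ ℕ.≡ᵇ m)
    X Y : ℚ
    X = [ admissible l j s c t ] /' ℕ→ℚ (count (admissible l j s c) all)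
    Y = Π d Πd m c * inv (Cmu * Q)
    cases : Dec (s ⊆ c) → Dec (∣ c ∣ ≡ m) → [ ⊆ᵇ s c ] * Y * X ≡ [ B c ] * mass c * K
    cases (no s⊈c) _ = begin
      [ ⊆ᵇ s c ] * Y * X     ≡⟨ cong (λ x → [ x ] * Y * X) (⊆ᵇ-false s⊈c) ⟩
      0ℚ * Y * X             ≡⟨ trans (cong (_* X) (ℚₚ.*-zeroˡ Y)) (ℚₚ.*-zeroˡ X) ⟩
      0ℚ                     ≡⟨ trans (cong (_* K) (ℚₚ.*-zeroˡ (mass c))) (ℚₚ.*-zeroˡ K) ⟨
      0ℚ * mass c * K        ≡⟨ cong (λ x → [ x ∧ (∣ c ∣ ℕ.≡ᵇ m) ] * mass c * K) (⊆ᵇ-false b⊈c) ⟨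
      [ B c ] * mass c * K ∎
      where
      b⊈c : ¬ b ⊆ c
      b⊈c b⊆c = s⊈c (⊆-trans (p⊆p∪q t′) b⊆c)
    cases (yes s⊆c) (no ∣c∣≢m) = begin
      [ ⊆ᵇ s c ] * Y * X                           ≡⟨ cong (λ x → [ ⊆ᵇ s c ] * (x * inv (Cmu * Q)) * X) (Π-≢ c ∣c∣≢m) ⟩
      [ ⊆ᵇ s c ] * (0ℚ * inv (Cmu * Q)) * X        ≡⟨ cong (λ x → [ ⊆ᵇ s c ] * x * X) (ℚₚ.*-zeroˡ (inv (Cmu * Q))) ⟩
      [ ⊆ᵇ s c ] * 0ℚ * X                          ≡⟨ trans (cong (_* X) (ℚₚ.*-zeroʳ [ ⊆ᵇ s c ])) (ℚₚ.*-zeroˡ X) ⟩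
      0ℚ                                           ≡⟨ trans (cong (_* K) (ℚₚ.*-zeroˡ (mass c))) (ℚₚ.*-zeroˡ K) ⟨
      0ℚ * mass c * K                              ≡⟨ cong (λ x → [ x ] * mass c * K)
                                                        (trans (cong (⊆ᵇ b c ∧_) (≢⇒≡ᵇ ∣c∣≢m)) (Boolₚ.∧-zeroʳ (⊆ᵇ b c))) ⟨
      [ B c ] * mass c * K ∎
    cases (yes s⊆c) (yes ∣c∣≡m) = begin
      [ ⊆ᵇ s c ] * Y * X
        ≡⟨ cong (λ x → [ x ] * Y * X) (⊆ᵇ-true s⊆c) ⟩
      1ℚ * Y * X
        ≡⟨ cong (_* X) (ℚₚ.*-identityˡ Y) ⟩
      Π d Πd m c * inv (Cmu * Q) * X
        ≡⟨ cong₂ (λ p x → p * inv (Cmu * Q) * x) (Π-≡ c ∣c∣≡m)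
             (admissible-weight j≤l ∣s∣≡k s′⊆s ∣t′∣≡j empty ∣s′∪t′∣≡l s⊆c ∣c∣≡m) ⟩
      mass c * inv Dm * inv (Cmu * Q) * ([ ⊆ᵇ t′ c ] * inv (Ckl * Cuj))
        ≡⟨ shuffle (mass c) (inv Dm) (inv (Cmu * Q)) [ ⊆ᵇ t′ c ] (inv (Ckl * Cuj)) ⟩
      [ ⊆ᵇ t′ c ] * mass c * K
        ≡⟨ cong (λ x → [ x ] * mass c * K) Bc≡[t′⊆c] ⟨
      [ B c ] * mass c * K ∎
      where
      shuffle : ∀ w a q x y → w * a * q * (x * y) ≡ x * w * (a * (q * y))
      shuffle = solve 5 (λ w a q x y → w :* a :* q :* (x :* y) := x :* w :* (a :* (q :* y))) refl
      Bc≡[t′⊆c] : B c ≡ ⊆ᵇ t′ c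
      Bc≡[t′⊆c] = trans (cong₂ _∧_ (⊆ᵇ-∪ t′ s⊆c) (≡⇒≡ᵇ ∣c∣≡m)) (Boolₚ.∧-identityʳ (⊆ᵇ t′ c))

  Swalk-closed : ∀ {j l k u} {s s′ t′ : Subset n} → j ≤ l → j ≤ u → k + u ≤ d →
    ∣ s ∣ ≡ k → Π d Πd k s ≢ 0ℚ → s′ ⊆ s → ∣ t′ ∣ ≡ j → Empty (t′ ∩ s) → ∣ s′ ∪ t′ ∣ ≡ l →
    Swalk d Πd u k l j s (s′ ∪ t′)
      ≡ (1ℚ /' ℕ→ℚ ((k C (l ∸ j)) ℕ.* ((k + j) C j))) * (Π d Πd (k + j) (s ∪ t′) /' Π d Πd k s)
  Swalk-closed {j} {l} {k} {u} {s} {s′} {t′} j≤l j≤u k+u≤d ∣s∣≡k Πs≢0 s′⊆s ∣t′∣≡j empty ∣s′∪t′∣≡l = begin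
    Σsub (λ c → pUp d Πd u s c * ([ admissible l j s c (s′ ∪ t′) ] /' ℕ→ℚ (count (admissible l j s c) all)))
      ≡⟨ ∑-cong all (Swalk-summand j≤l ∣s∣≡k Πs≢0 s′⊆s ∣t′∣≡j empty ∣s′∪t′∣≡l) ⟩
    Σsub (λ c → [ ⊆ᵇ b c ∧ (∣ c ∣ ℕ.≡ᵇ (k + u)) ] * mass c * K)
      ≡⟨ ∑-*ʳ all K (λ c → [ ⊆ᵇ b c ∧ (∣ c ∣ ℕ.≡ᵇ (k + u)) ] * mass c) ⟩
    Σsub (λ c → [ ⊆ᵇ b c ∧ (∣ c ∣ ℕ.≡ᵇ (k + u)) ] * mass c) * K
      ≡⟨ cong (_* K) (∑-mass-supersets b (u ∸ j) (k + u) k+u≡∣b∣+[u∸j]) ⟩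
    ℕ→ℚ ((d ∸ ∣ b ∣) C (u ∸ j)) * mass b * K
      ≡⟨ cong (λ x → ℕ→ℚ ((d ∸ x) C (u ∸ j)) * mass b * K) ∣b∣≡k+j ⟩
    ℕ→ℚ ((d ∸ (k + j)) C (u ∸ j)) * mass b * K
      ≡⟨ C-swap-constants k j u d Ckl (mass b) Q j≤u k+u≤d ⟩
    inv (Ckl * ckj) * (mass b * inv (ℕ→ℚ (d C (k + j))) * inv Q)
      ≡⟨ cong₂ (λ x y → inv x * (y * inv Q)) (ℕ→ℚ-* (k C (l ∸ j)) ((k + j) C j)) (Π-≡ b ∣b∣≡k+j) ⟨
    inv (ℕ→ℚ ((k C (l ∸ j)) ℕ.* ((k + j) C j))) * (Π d Πd (k + j) b * inv Q)
      ≡⟨ cong (inv (ℕ→ℚ ((k C (l ∸ j)) ℕ.* ((k + j) C j))) *_) (/'≡*inv (Π d Πd (k + j) b) Q) ⟨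
    (1ℚ /' ℕ→ℚ ((k C (l ∸ j)) ℕ.* ((k + j) C j))) * (Π d Πd (k + j) b /' Q) ∎
    where
    all : List (Subset n)
    all = allSubsets n
    b : Subset n
    b = s ∪ t′
    Q Ckl ckj K : ℚ
    Q = Π d Πd k s
    Ckl = ℕ→ℚ (k C (l ∸ j))
    ckj = ℕ→ℚ ((k + j) C j)
    K = inv (ℕ→ℚ (d C (k + u))) * (inv (ℕ→ℚ ((k + u) C u) * Q) * inv (Ckl * ℕ→ℚ (u C j)))
    ∣b∣≡k+j : ∣ b ∣ ≡ k + j
    ∣b∣≡k+j = trans (∣p∪q∣≡∣p∣+∣q∣ s t′ empty) (cong₂ _+_ ∣s∣≡k ∣t′∣≡j)
    k+u≡∣b∣+[u∸j] : k + u ≡ ∣ b ∣ + (u ∸ j)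
    k+u≡∣b∣+[u∸j] = begin
      k + u              ≡⟨ cong (k +_) (ℕₚ.m+[n∸m]≡n j≤u) ⟨
      k + (j + (u ∸ j))  ≡⟨ ℕₚ.+-assoc k j (u ∸ j) ⟨
      k + j + (u ∸ j)    ≡⟨ cong (_+ (u ∸ j)) ∣b∣≡k+j ⟨
      ∣ b ∣ + (u ∸ j) ∎

module _ where
  open import Data.Nat using (_+_; _≤_)
  open import Data.Rational using (_<_; _*_)

  lemma4p10 : (n d : ℕ) (X : Subset n → Bool) → IsSimplicialComplex X → IsPure X d →
      (Πd : Subset n → ℚ) → IsTopMeasure X d Πd →
      (j l k u : ℕ) → j ≤ l → l ≤ k → j ≤ u → u ≤ d ∸ k → k ≤ d →
      (s : Subset n) → X s ≡ true → ∣ s ∣ ≡ k → 0ℚ < Π d Πd k s →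
      (s' : Subset n) → s' ⊆ s → ∣ s' ∣ ≡ l ∸ j →
      (t' : Subset n) → X t' ≡ true → ∣ t' ∣ ≡ j → Empty (t' ∩ s) →
      X (s' ∪ t') ≡ true → ∣ s' ∪ t' ∣ ≡ l →
      Swalk d Πd u k l j s (s' ∪ t')
        ≡ (1ℚ /' ℕ→ℚ ((k C (l ∸ j)) Data.Nat.* ((k + j) C j)))
            * (Π d Πd (k + j) (s ∪ t') /' Π d Πd k s)
  lemma4p10 n d _ _ _ Πd μ j l k u j≤l _ j≤u u≤d∸k k≤d s _ ∣s∣≡k 0<Πs s′ s′⊆s _ t′ _ ∣t′∣≡j empty _ ∣s′∪t′∣≡l =
    Measure.Swalk-closed d Πd (IsTopMeasure.nonneg μ) (λ f Πf≢0 → proj₂ (IsTopMeasure.support μ f Πf≢0))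
      j≤l j≤u k+u≤d ∣s∣≡k Πs≢0 s′⊆s ∣t′∣≡j empty ∣s′∪t′∣≡l
    where
    k+u≤d : k + u ≤ d
    k+u≤d = ℕₚ.≤-trans (ℕₚ.+-monoʳ-≤ k u≤d∸k) (ℕₚ.≤-reflexive (ℕₚ.m+[n∸m]≡n k≤d))
    Πs≢0 : Π d Πd k s ≢ 0ℚ
    Πs≢0 = ≢-sym (ℚₚ.<⇒≢ 0<Πs)
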